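{- Fix an integer $b\ge 1$. For every integer $h\ge 1$, the set of stacks of $h$ words over $\Sigma_b$ that are accepted by the automaton $\mathcal{A}_b$ (defined in the context) is in bijection with the set of polyominoes inscribed in a rectangle of size $b\times h$.
   Context: A polyomino is a finite nonempty set of cells of the square lattice that is edge-connected. A polyomino is inscribed in a $b\times h$ rectangle if it is contained in that rectangle and has at least one cell in each of the four extreme rows/columns (top, bottom, leftmost, rightmost) of the rectangle. Such a polyomino can be encoded as a stack of $h$ rows, each row being a word $u=u_1\cdots u_b\in\{0,1\}^b$ with $u_i=1$ iff the $i$-th cell of that row is selected. Write $|u|_1$ for the number of $1$'s in $u$, and for a word $w$ and a letter $a$ let $\mathrm{pos}_a(w)=\{i: w_i=a\}$. Let $m=\lceil b/2\rceil$. States. Let $\mathcal{T}_b$ be the set of triples $(w,l,r)$ with $w=w_1\cdots w_b\in\{0,1,\dots,m\}^b$ and $l,r\in\{\mathrm{True},\mathrm{False}\}$ satisfying: (Empty row) if $w=0^b$ then $l=r=\mathrm{False}$; (Inscription) if $w_1\ne0$ then $l=\mathrm{True}$, and if $w_b\neq 0$ then $r=\mathrm{True}$; (Separation) if $w_i\neq0$ then $w_{i-1},w_{i+1}\in\{0,w_i\}$ (whenever these indices exist); (Non-crossing) for positions $i<k<j<l'$ in $\{1,\dots,b\}$, if $w_i=w_j\neq 0$ and $w_k=w_{l'}\ne 0$ then $w_i=w_k$. Two words $w,w'$ are equivalent if $\mathrm{pos}_0(w)=\mathrm{pos}_0(w')$ and there is a permutation $\sigma$ of $\{1,\dots,m\}$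 with $\mathrm{pos}_i(w)=\mathrm{pos}_{\sigma(i)}(w')$ for all $i\in\{1,\dots,m\}$; $[w]$ denotes the lexicographically minimal word in the class of $w$. The automaton $\mathcal{A}_b=(\Sigma_b,Q_b,q_{0},F_b,\delta_b)$ has alphabet $\Sigma_b=\{u\in\{0,1\}^b: |u|_1>0\}$, states $Q_b=\{([w],l,r): (w,l,r)\in\mathcal{T}_b\}$, initial state $q_0=(0^b,\mathrm{False},\mathrm{False})$, and accepting states $F_b=\{([w],l,r)\in Q_b: w\in\{0,1\}^b,\ l=r=\mathrm{True}\}$ (a single component, touching both sides). Transitions. $\delta_b(([w],l,r),u)$ is defined only if for every letter $a\ne 0$ with $\mathrm{pos}_a(w)\neq\emptyset$ we have $\mathrm{pos}_a(w)\cap\mathrm{pos}_1(u)\neq\emptyset$. Then $\delta_b(([w],l,r),u)=([w'],l',r')$ computed as follows. (Vertical step) Reading $u$ left to right, build $x$: if $u_i=0$ then $x_i=0$; if $u_i=1$ and $w_i\neq0$ then $x_i=w_i$; if $u_i=1$ and $w_i=0$ then $x_i=N+1$ with $N=\max\{w_1,\dots,w_b,x_1,\dots,x_{i-1}\}$. (Horizontal step) The horizontally connected components of $x$ are its maximal factors containing no $0$. Two such components are directly linked if they share a letter; let "linked" be the transitive closure of this relation, and group components into linked classes. Assign letters $1,2,\dots$ to the classes in increasing order, each time to the not-yet-labelled class containing the leftmost component among the unlabelled classes. Then $w'$ is obtained from $x$ by replacing every letter of every component by the letter of its class (zeros stay zeros). (Adjacency) $l'=l\vee(u_1=1)$ and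 $r'=r\vee(u_b=1)$. A stack of $h$ words $u^{(1)},\dots,u^{(h)}\in\Sigma_b$ (read from top to bottom) is accepted by $\mathcal{A}_b$ if starting from $q_0$ the successive transitions $\delta_b(\cdot,u^{(1)}),\dots,\delta_b(\cdot,u^{(h)})$ are all defined and the final state lies in $F_b$. -}

module Defs where

open import Data.Bool using (Bool; true; false; _∧_; _∨_; if_then_else_; not)
open import Data.Nat using (ℕ; zero; suc; _⊔_; _≡ᵇ_; _≤ᵇ_; _≤_)
open import Data.Fin using (Fin; toℕ)
open import Data.List as L using (List; []; _∷_; _++_; _∷ʳ_; concat; length; foldr; replicate; map)
open import Data.Bool.ListAction using (any; all)
open import Data.Vec as V using (Vec; lookup)
open import Data.Maybe using (Maybe; just; nothing; _>>=_)
open import Data.Product using (_×_; _,_; ∃; ∃-syntax; proj₁; proj₂)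
open import Data.Sum using (_⊎_)
open import Relation.Binary.PropositionalEquality using (_≡_)
open import Relation.Binary.Construct.Closure.ReflexiveTransitive using (Star)

-- A subset of the cells of the b × h rectangle: row index i : Fin h
-- (top to bottom), column index j : Fin b (left to right).
Cells : ℕ → ℕ → Set
Cells b h = Fin h → Fin b → Bool

Cell : ℕ → ℕ → Set
Cell b h = Fin h × Fin b

Selected : ∀ {b h} → Cells b h → Cell b h → Set
Selected P (i , j) = P i j ≡ true

Adjacent : ∀ {b h} → Cell b h → Cell b h → Set
Adjacent (i , j) (i' , j') =
  (i ≡ i' × (suc (toℕ j) ≡ toℕ j' ⊎ suc (toℕ j') ≡ toℕ j))
  ⊎ (j ≡ j' × (suc (toℕ i) ≡ toℕ i' ⊎ suc (toℕ i') ≡ toℕ i))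

Step : ∀ {b h} → Cells b h → Cell b h → Cell b h → Set
Step P c d = Selected P c × Selected P d × Adjacent c d

EdgeConnected : ∀ {b h} → Cells b h → Set
EdgeConnected P = ∀ c d → Selected P c → Selected P d → Star (Step P) c d

IsPolyomino : ∀ {b h} → Cells b h → Set
IsPolyomino P = (∃[ c ] Selected P c) × EdgeConnected P

Inscribed : ∀ {b h} → Cells b h → Set
Inscribed {b} {h} P =
  IsPolyomino P
  × (∃[ i ] ∃[ j ] (P i j ≡ true × toℕ i ≡ 0))
  × (∃[ i ] ∃[ j ] (P i j ≡ true × suc (toℕ i) ≡ h))
  × (∃[ i ] ∃[ j ] (P i j ≡ true × toℕ j ≡ 0))
  × (∃[ i ] ∃[ j ] (P i j ≡ true × suc (toℕ j) ≡ b))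

-- a stack of h words of length b, read from top to bottom
Stack : ℕ → ℕ → Set
Stack b h = Vec (Vec Bool b) h

InΣ : ∀ {b} → Vec Bool b → Set
InΣ u = ∃[ j ] lookup u j ≡ true

StackOverΣ : ∀ {b h} → Stack b h → Set
StackOverΣ s = ∀ i → InΣ (lookup s i)

cellsOf : ∀ {b h} → Stack b h → Cells b h
cellsOf s i j = lookup (lookup s i) j

Word : Set
Word = List ℕ

member : ℕ → Word → Bool
member a ws = any (λ c → a ≡ᵇ c) ws

intersects : Word → Word → Bool
intersects xs ys = any (λ a → member a ys) xs

-- canonical representative [w]: relabel nonzero letters in order of first
-- occurrence (this is the lexicographically minimal word of the class).
lookupAssoc : ℕ → List (ℕ × ℕ) → Maybe ℕ
lookupAssoc a [] = nothing
lookupAssoc a ((k , v) ∷ t) = if a ≡ᵇ k then just v else lookupAssoc a t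

canonGo : List (ℕ × ℕ) → ℕ → Word → Word
canonGo tbl n [] = []
canonGo tbl n (zero ∷ w) = zero ∷ canonGo tbl n w
canonGo tbl n (suc a ∷ w) with lookupAssoc (suc a) tbl
... | just c  = c ∷ canonGo tbl n w
... | nothing = suc n ∷ canonGo ((suc a , suc n) ∷ tbl) (suc n) w

canon : Word → Word
canon w = canonGo [] 0 w

selectedLetters : Word → List Bool → Word
selectedLetters (a ∷ w) (true ∷ u) = a ∷ selectedLetters w u
selectedLetters (a ∷ w) (false ∷ u) = selectedLetters w u
selectedLetters _ _ = []

transitionDefined : Word → List Bool → Bool
transitionDefined w u = all (λ a → (a ≡ᵇ 0) ∨ member a (selectedLetters w u)) w

maxLetter : Word → ℕ
maxLetter = foldr _⊔_ 0

-- vertical step; the first argument is N = max{w_1..w_b, x_1..x_{i-1}}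
vertical : ℕ → Word → List Bool → Word
vertical M (a ∷ w) (false ∷ u) = 0 ∷ vertical M w u
vertical M (zero ∷ w) (true ∷ u) = suc M ∷ vertical (M ⊔ suc M) w u
vertical M (suc a ∷ w) (true ∷ u) = suc a ∷ vertical (M ⊔ suc a) w u
vertical M _ _ = []

-- horizontally connected components of x (maximal factors without 0),
-- each given by its list of letters, from left to right
componentsGo : Word → Word → List Word
componentsGo [] [] = []
componentsGo cur@(_ ∷ _) [] = cur ∷ []
componentsGo [] (zero ∷ x) = componentsGo [] x
componentsGo cur@(_ ∷ _) (zero ∷ x) = cur ∷ componentsGo [] x
componentsGo cur (suc a ∷ x) = componentsGo (cur ∷ʳ suc a) x

components : Word → List Word
components = componentsGo []

-- letters of the linked class of a component: closure under
-- "shares a letter", iterated (number of components) times, which suffices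
filterB : (Word → Bool) → List Word → List Word
filterB p [] = []
filterB p (c ∷ cs) = if p c then c ∷ filterB p cs else filterB p cs

grow : List Word → Word → Word
grow cs S = S ++ concat (filterB (λ c → intersects c S) cs)

iter : ℕ → (Word → Word) → Word → Word
iter zero f S = S
iter (suc n) f S = iter n f (f S)

classLetters : List Word → Word → Word
classLetters cs c = iter (length cs) (grow cs) c

labelGo : List Word → List (Word × ℕ) → ℕ → List Word → List (Word × ℕ)
labelGo cs lab n [] = lab
labelGo cs lab n (c ∷ rest) =
  if any (λ p → intersects c (proj₁ p)) lab
  then labelGo cs lab n rest
  else labelGo cs (lab ∷ʳ (classLetters cs c , suc n)) (suc n) rest

labelOf : List (Word × ℕ) → ℕ → ℕ
labelOf [] a = 0
labelOf ((S , k) ∷ t) a = if member a S then k else labelOf t a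

horizontal : Word → Word
horizontal x = map (λ a → if a ≡ᵇ 0 then 0 else labelOf tbl a) x
  where
  cs = components x
  tbl = labelGo cs [] 0 cs

State : Set
State = Word × Bool × Bool

initialState : ℕ → State
initialState b = (replicate b 0 , false , false)

headB : List Bool → Bool
headB [] = false
headB (x ∷ _) = x

lastB : List Bool → Bool
lastB [] = false
lastB (x ∷ []) = x
lastB (_ ∷ y ∷ t) = lastB (y ∷ t)

δ : State → List Bool → Maybe State
δ (w , l , r) u =
  if transitionDefined w u
  then just (canon (horizontal (vertical (maxLetter w) w u)) , l ∨ headB u , r ∨ lastB u)
  else nothing

run : State → List (List Bool) → Maybe State
run q [] = just q
run q (u ∷ us) = δ q u >>= λ q' → run q' us

IsAccepting : State → Set
IsAccepting (w , l , r) = (all (λ a → a ≤ᵇ 1) w ∧ l ∧ r) ≡ true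

stackRows : ∀ {b h} → Stack b h → List (List Bool)
stackRows s = L.map V.toList (V.toList s)

AcceptedBy : ∀ b {h} → Stack b h → Set
AcceptedBy b s = ∃[ q ] (run (initialState b) (stackRows s) ≡ just q × IsAccepting q)

-- After reading k rows, the state (w , l , r) records the connectivity of the cells selected
-- in those rows: the nonzero positions of w are the selected cells of the last row read, two of
-- them carry the same letter iff they are connected inside the first k rows, every selected
-- cell is connected to that row, and l, r record contact with the side columns. The vertical
-- step keeps old letters and gives new cells fresh ones, the horizontal step merges the
-- letters of linked cells, and canonical relabelling preserves which positions carry equal
-- letters, so the invariant survives each transition. A transition is undefined exactly when
-- a component fails to reach the new row, which cannot happen in an inscribed polyomino before
-- its bottom row, and an accepting state carries a single letter, i.e. a single component.

module Submission where

open import Defs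
open import Data.Nat using (ℕ; _≤_)
open import Data.Product using (_×_)
open import Function.Bundles using (_⇔_)

open import Data.Bool using (Bool; true; false; _∧_; _∨_; if_then_else_)
open import Data.Bool.ListAction using (any; all)
open import Data.Bool.Properties using (T-≡; ∨-zeroʳ)
open import Data.Empty using (⊥-elim)
open import Data.Fin as F using (Fin; toℕ)
open import Data.Fin.Properties using (toℕ-fromℕ<; toℕ-injective; toℕ<n)
open import Data.List using (List; []; _∷_; _∷ʳ_; length; map; replicate; drop)
open import Data.List.Membership.Propositional using (_∈_; find; lose)
open import Data.List.Membership.Propositional.Properties using (∈-length; ∈-++⁺ˡ; ∈-++⁺ʳ; ∈-++⁻; ∈-concat⁺′; ∈-concat⁻′)
open import Data.List.Properties using (length-map; length-replicate)
open import Data.List.Relation.Binary.Subset.Propositional using (_⊆_)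
open import Data.List.Relation.Unary.All as All using ()
open import Data.List.Relation.Unary.All.Properties using (all⁺; all⁻)
open import Data.List.Relation.Unary.Any using (here; there)
open import Data.List.Relation.Unary.Any.Properties using (any⁺; any⁻)
open import Data.Maybe using (just; nothing)
open import Data.Maybe.Properties using (just-injective)
open import Data.Nat using (zero; suc; _<_; _⊔_; _≡ᵇ_; _≤ᵇ_; _≟_; _<?_; z≤n; s≤s; s≤s⁻¹; pred)
open import Data.Nat.Properties
open import Data.Product using (_,_; ∃-syntax; proj₁; proj₂; map₁; map₂)
open import Data.Sum using (_⊎_; inj₁; inj₂; [_,_]′) renaming (map₂ to ⊎-map₂)
open import Data.Vec as V using (Vec; lookup)
open import Data.Vec.Properties using (length-toList)
open import Function.Bundles using (mk⇔; Equivalence)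
open import Relation.Binary.Construct.Closure.ReflexiveTransitive using (Star; ε; _◅_; _◅◅_; gmap; reverse)
open import Relation.Binary.PropositionalEquality using (_≡_; _≢_; refl; sym; trans; cong; cong₂; subst)
open import Relation.Nullary using (¬_; yes; no; contradiction)

open Equivalence using (to; from)

∨≡true⁻ : ∀ b c → b ∨ c ≡ true → b ≡ true ⊎ c ≡ true
∨≡true⁻ true c _ = inj₁ refl
∨≡true⁻ false c e = inj₂ e

∨≡trueʳ : ∀ b {c} → c ≡ true → b ∨ c ≡ true
∨≡trueʳ b refl = ∨-zeroʳ b

∧≡true⁻ : ∀ b c → b ∧ c ≡ true → b ≡ true × c ≡ true
∧≡true⁻ true c e = refl , e

≡ᵇ≡true⁻ : ∀ m n → (m ≡ᵇ n) ≡ true → m ≡ n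
≡ᵇ≡true⁻ m n e = ≡ᵇ⇒≡ m n (from T-≡ e)

≡ᵇ-refl : ∀ m → (m ≡ᵇ m) ≡ true
≡ᵇ-refl m = to T-≡ (≡⇒≡ᵇ m m refl)

≢⇒≡ᵇ≡false : ∀ m n → m ≢ n → (m ≡ᵇ n) ≡ false
≢⇒≡ᵇ≡false m n m≢n with m ≡ᵇ n in eq
... | true = ⊥-elim (m≢n (≡ᵇ≡true⁻ m n eq))
... | false = refl

module _ {A : Set} (p : A → Bool) where

  any≡true⁻ : ∀ xs → any p xs ≡ true → ∃[ x ] (x ∈ xs × p x ≡ true)
  any≡true⁻ xs e with find (any⁻ p xs (from T-≡ e))
  ... | x , x∈xs , px = x , x∈xs , to T-≡ px

  any≡true⁺ : ∀ {xs x} → x ∈ xs → p x ≡ true → any p xs ≡ true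
  any≡true⁺ x∈xs px = to T-≡ (any⁺ p (lose x∈xs (from T-≡ px)))

  all≡true⁻ : ∀ xs → all p xs ≡ true → ∀ {x} → x ∈ xs → p x ≡ true
  all≡true⁻ xs e x∈xs = to T-≡ (All.lookup (all⁺ p xs (from T-≡ e)) x∈xs)

  all≡true⁺ : ∀ xs → (∀ {x} → x ∈ xs → p x ≡ true) → all p xs ≡ true
  all≡true⁺ xs h = to T-≡ (all⁻ p (All.tabulate (λ x∈xs → from T-≡ (h x∈xs))))

member⁻ : ∀ a ws → member a ws ≡ true → a ∈ ws
member⁻ a ws e with any≡true⁻ (a ≡ᵇ_) ws e
... | c , c∈ws , a≡c rewrite ≡ᵇ≡true⁻ a c a≡c = c∈ws

member⁺ : ∀ {a ws} → a ∈ ws → member a ws ≡ true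
member⁺ {a} a∈ws = any≡true⁺ (a ≡ᵇ_) a∈ws (≡ᵇ-refl a)

member≡false⇒∉ : ∀ {a ws} → member a ws ≡ false → ¬ (a ∈ ws)
member≡false⇒∉ e a∈ws with trans (sym (member⁺ a∈ws)) e
... | ()

member-cong : ∀ {a a' ws} → (a ∈ ws → a' ∈ ws) → (a' ∈ ws → a ∈ ws) → member a ws ≡ member a' ws
member-cong {a} {a'} {ws} f g with member a ws in e | member a' ws in e'
... | true | true = refl
... | false | false = refl
... | true | false = ⊥-elim (member≡false⇒∉ e' (f (member⁻ a ws e)))
... | false | true = ⊥-elim (member≡false⇒∉ e (g (member⁻ a' ws e')))

intersects⁻ : ∀ xs ys → intersects xs ys ≡ true → ∃[ a ] (a ∈ xs × a ∈ ys)
intersects⁻ xs ys e with any≡true⁻ (λ a → member a ys) xs e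
... | a , a∈xs , a∈ys = a , a∈xs , member⁻ a ys a∈ys

intersects⁺ : ∀ {xs ys a} → a ∈ xs → a ∈ ys → intersects xs ys ≡ true
intersects⁺ {ys = ys} a∈xs a∈ys = any≡true⁺ (λ a → member a ys) a∈xs (member⁺ a∈ys)

intersects-monoʳ : ∀ xs {S S'} → S ⊆ S' → intersects xs S ≡ true → intersects xs S' ≡ true
intersects-monoʳ xs {S} S⊆S' e with intersects⁻ xs S e
... | a , a∈xs , a∈S = intersects⁺ a∈xs (S⊆S' a∈S)

-- Positions past the end of a list read as the default.

nthOr : {A : Set} → A → List A → ℕ → A
nthOr d [] _ = d
nthOr d (x ∷ xs) zero = x
nthOr d (x ∷ xs) (suc j) = nthOr d xs j

at : Word → ℕ → ℕ
at = nthOr 0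

bitAt : List Bool → ℕ → Bool
bitAt = nthOr false

rowAt : List (List Bool) → ℕ → List Bool
rowAt = nthOr []

at-∈ : ∀ xs j → at xs j ≢ 0 → at xs j ∈ xs
at-∈ [] j ne = ⊥-elim (ne refl)
at-∈ (x ∷ xs) zero ne = here refl
at-∈ (x ∷ xs) (suc j) ne = there (at-∈ xs j ne)

∈⇒at : ∀ {a xs} → a ∈ xs → ∃[ j ] (at xs j ≡ a × j < length xs)
∈⇒at (here refl) = 0 , refl , s≤s z≤n
∈⇒at (there a∈xs) with ∈⇒at a∈xs
... | j , e , j< = suc j , e , s≤s j<

nthOr≢default⇒<length : ∀ {A : Set} {d : A} xs j → nthOr d xs j ≢ d → j < length xs
nthOr≢default⇒<length [] j ne = ⊥-elim (ne refl)
nthOr≢default⇒<length (x ∷ xs) zero ne = s≤s z≤n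
nthOr≢default⇒<length (x ∷ xs) (suc j) ne = s≤s (nthOr≢default⇒<length xs j ne)

at-map : ∀ (f : ℕ → ℕ) → f 0 ≡ 0 → ∀ xs j → at (map f xs) j ≡ f (at xs j)
at-map f f0 [] j = sym f0
at-map f f0 (x ∷ xs) zero = refl
at-map f f0 (x ∷ xs) (suc j) = at-map f f0 xs j

at-replicate-0 : ∀ n j → at (replicate n 0) j ≡ 0
at-replicate-0 zero j = refl
at-replicate-0 (suc n) zero = refl
at-replicate-0 (suc n) (suc j) = at-replicate-0 n j

<⇒suc-pred≡ : ∀ {i k} → i < k → suc (pred k) ≡ k
<⇒suc-pred≡ (s≤s _) = refl

-- Canonical relabelling

Table : Set
Table = List (ℕ × ℕ)

relabel : Table → ℕ → ℕ
relabel t zero = 0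
relabel t (suc a) with lookupAssoc (suc a) t
... | just c = c
... | nothing = 0

Extends : Table → Table → Set
Extends t t' = ∀ a c → lookupAssoc a t ≡ just c → lookupAssoc a t' ≡ just c

LabelsIn : ℕ → Table → Set
LabelsIn n t = ∀ a c → lookupAssoc a t ≡ just c → c ≢ 0 × c ≤ n

InjectiveTable : Table → Set
InjectiveTable t = ∀ a a' c → lookupAssoc a t ≡ just c → lookupAssoc a' t ≡ just c → a ≡ a'

relabel-just : ∀ t a {c} → a ≢ 0 → lookupAssoc a t ≡ just c → relabel t a ≡ c
relabel-just t zero ne _ = ⊥-elim (ne refl)
relabel-just t (suc a) ne e rewrite e = refl

record CanonGoSpec (tbl : Table) (out w : Word) : Set where
  field
    table : Table
    extends : Extends tbl table
    nonzero : ∀ a c → lookupAssoc a table ≡ just c → c ≢ 0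
    injective : InjectiveTable table
    pointwise : ∀ j → at out j ≡ relabel table (at w j)
    defined : ∀ j → at w j ≢ 0 → ∃[ c ] lookupAssoc (at w j) table ≡ just c

canonGo-spec : ∀ tbl n w → LabelsIn n tbl → InjectiveTable tbl → CanonGoSpec tbl (canonGo tbl n w) w
canonGo-spec tbl n [] bounded inj = record
  { table = tbl ; extends = λ _ _ e → e ; nonzero = λ a c e → proj₁ (bounded a c e) ; injective = inj
  ; pointwise = λ j → refl ; defined = λ j ne → ⊥-elim (ne refl) }
canonGo-spec tbl n (zero ∷ w) bounded inj = record
  { table = table ; extends = extends ; nonzero = nonzero ; injective = injective
  ; pointwise = λ { zero → refl ; (suc j) → pointwise j }
  ; defined = λ { zero ne → ⊥-elim (ne refl) ; (suc j) ne → defined j ne } }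
  where open CanonGoSpec (canonGo-spec tbl n w bounded inj)
canonGo-spec tbl n (suc a ∷ w) bounded inj with lookupAssoc (suc a) tbl in old
... | just c = record
  { table = table ; extends = extends ; nonzero = nonzero ; injective = injective
  ; pointwise = λ { zero → sym (relabel-just table (suc a) (λ ()) (extends (suc a) c old)) ; (suc j) → pointwise j }
  ; defined = λ { zero _ → c , extends (suc a) c old ; (suc j) ne → defined j ne } }
  where open CanonGoSpec (canonGo-spec tbl n w bounded inj)
... | nothing = record
  { table = table ; extends = λ x d e → extends x d (extends₁ x d e) ; nonzero = nonzero ; injective = injective
  ; pointwise = λ { zero → sym (relabel-just table (suc a) (λ ()) new) ; (suc j) → pointwise j }
  ; defined = λ { zero _ → suc n , new ; (suc j) ne → defined j ne } }
  where
  tbl₁ = (suc a , suc n) ∷ tbl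
  extends₁ : Extends tbl tbl₁
  extends₁ x d e with x ≡ᵇ suc a in x≡
  ... | true rewrite ≡ᵇ≡true⁻ x (suc a) x≡ with trans (sym e) old
  ... | ()
  extends₁ x d e | false = e
  bounded₁ : LabelsIn (suc n) tbl₁
  bounded₁ x d e with x ≡ᵇ suc a
  ... | true = subst (λ z → z ≢ 0 × z ≤ suc n) (just-injective e) ((λ ()) , ≤-refl)
  ... | false = proj₁ (bounded x d e) , m≤n⇒m≤1+n (proj₂ (bounded x d e))
  -- the new label suc n exceeds every old label
  injective₁ : InjectiveTable tbl₁
  injective₁ x x' d e e' with x ≡ᵇ suc a in x≡ | x' ≡ᵇ suc a in x'≡
  ... | true | true = trans (≡ᵇ≡true⁻ x (suc a) x≡) (sym (≡ᵇ≡true⁻ x' (suc a) x'≡))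
  ... | true | false = ⊥-elim (1+n≰n (subst (_≤ n) (sym (just-injective e)) (proj₂ (bounded x' d e'))))
  ... | false | true = ⊥-elim (1+n≰n (subst (_≤ n) (sym (just-injective e')) (proj₂ (bounded x d e))))
  ... | false | false = inj x x' d e e'
  open CanonGoSpec (canonGo-spec tbl₁ (suc n) w bounded₁ injective₁)
  new : lookupAssoc (suc a) table ≡ just (suc n)
  new = extends (suc a) (suc n) (subst (λ z → (if z then just (suc n) else lookupAssoc (suc a) tbl) ≡ just (suc n))
                                        (sym (≡ᵇ-refl a)) refl)

canonGo-length : ∀ tbl n w → length (canonGo tbl n w) ≡ length w
canonGo-length tbl n [] = refl
canonGo-length tbl n (zero ∷ w) = cong suc (canonGo-length tbl n w)
canonGo-length tbl n (suc a ∷ w) with lookupAssoc (suc a) tbl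
... | just c = cong suc (canonGo-length tbl n w)
... | nothing = cong suc (canonGo-length _ (suc n) w)

canon-length : ∀ w → length (canon w) ≡ length w
canon-length = canonGo-length [] 0

canon-spec : ∀ w → CanonGoSpec [] (canon w) w
canon-spec w = canonGo-spec [] 0 w (λ a c ()) (λ a a' c ())

module _ (w : Word) where
  open CanonGoSpec (canon-spec w)

  canon-≡0⁻ : ∀ j → at (canon w) j ≡ 0 → at w j ≡ 0
  canon-≡0⁻ j e with at w j ≟ 0
  ... | yes z = z
  ... | no nz with defined j nz
  ... | c , def = ⊥-elim (nonzero (at w j) c def (trans (sym (relabel-just table (at w j) nz def)) (trans (sym (pointwise j)) e)))

  canon-≡0⁺ : ∀ j → at w j ≡ 0 → at (canon w) j ≡ 0
  canon-≡0⁺ j e = trans (pointwise j) (cong (relabel table) e)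

  canon-≡⁺ : ∀ j j' → at w j ≡ at w j' → at (canon w) j ≡ at (canon w) j'
  canon-≡⁺ j j' e = trans (pointwise j) (trans (cong (relabel table) e) (sym (pointwise j')))

  canon-≡⁻ : ∀ j j' → at w j ≢ 0 → at (canon w) j ≡ at (canon w) j' → at w j ≡ at w j'
  canon-≡⁻ j j' nz e with at w j' ≟ 0
  ... | yes z = ⊥-elim (nz (canon-≡0⁻ j (trans e (canon-≡0⁺ j' z))))
  ... | no nz' with defined j nz | defined j' nz'
  ... | c , def | c' , def' = injective (at w j) (at w j') c def (trans def' (cong just (sym c≡c')))
    where
    c≡c' : c ≡ c'
    c≡c' = trans (sym (relabel-just table (at w j) nz def))
          (trans (sym (pointwise j)) (trans e (trans (pointwise j') (relabel-just table (at w j') nz' def'))))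

canon-zeros⊎one : ∀ w → (∀ j → at (canon w) j ≡ 0) ⊎ (∃[ j ] at (canon w) j ≡ 1)
canon-zeros⊎one [] = inj₁ (λ j → refl)
canon-zeros⊎one (zero ∷ w) with canon-zeros⊎one w
... | inj₁ zeros = inj₁ (λ { zero → refl ; (suc j) → zeros j })
... | inj₂ (j , one) = inj₂ (suc j , one)
canon-zeros⊎one (suc a ∷ w) = inj₂ (0 , refl)

-- The vertical step

Bounded : ℕ → Word → Set
Bounded M w = ∀ j → at w j ≤ M

maxLetter-bounded : ∀ w → Bounded (maxLetter w) w
maxLetter-bounded [] j = z≤n
maxLetter-bounded (a ∷ w) zero = m≤m⊔n a (maxLetter w)
maxLetter-bounded (a ∷ w) (suc j) = ≤-trans (maxLetter-bounded w j) (m≤n⊔m a (maxLetter w))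

bounded-tail : ∀ {M} a w c → Bounded M (a ∷ w) → Bounded (M ⊔ c) w
bounded-tail {M} a w c bnd j = ≤-trans (bnd (suc j)) (m≤m⊔n M c)

vertical-length : ∀ M w u → length w ≡ length u → length (vertical M w u) ≡ length u
vertical-length M [] [] e = refl
vertical-length M (a ∷ w) (false ∷ u) e = cong suc (vertical-length M w u (suc-injective e))
vertical-length M (zero ∷ w) (true ∷ u) e = cong suc (vertical-length _ w u (suc-injective e))
vertical-length M (suc a ∷ w) (true ∷ u) e = cong suc (vertical-length _ w u (suc-injective e))

vertical-unselected : ∀ M w u j → bitAt u j ≡ false → at (vertical M w u) j ≡ 0
vertical-unselected M [] u j e = refl
vertical-unselected M (a ∷ w) [] j e = refl
vertical-unselected M (a ∷ w) (false ∷ u) zero e = refl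
vertical-unselected M (a ∷ w) (false ∷ u) (suc j) e = vertical-unselected M w u j e
vertical-unselected M (zero ∷ w) (true ∷ u) (suc j) e = vertical-unselected _ w u j e
vertical-unselected M (suc a ∷ w) (true ∷ u) (suc j) e = vertical-unselected _ w u j e

vertical-selected : ∀ M w u j → length w ≡ length u → bitAt u j ≡ true → at (vertical M w u) j ≢ 0
vertical-selected M [] [] j _ ()
vertical-selected M (a ∷ w) (false ∷ u) (suc j) e t = vertical-selected M w u j (suc-injective e) t
vertical-selected M (zero ∷ w) (true ∷ u) zero e t = λ ()
vertical-selected M (zero ∷ w) (true ∷ u) (suc j) e t = vertical-selected _ w u j (suc-injective e) t
vertical-selected M (suc a ∷ w) (true ∷ u) zero e t = λ ()
vertical-selected M (suc a ∷ w) (true ∷ u) (suc j) e t = vertical-selected _ w u j (suc-injective e) t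

vertical-old : ∀ M w u j → bitAt u j ≡ true → at w j ≢ 0 → at (vertical M w u) j ≡ at w j
vertical-old M [] u j t ne = ⊥-elim (ne refl)
vertical-old M (a ∷ w) [] j () ne
vertical-old M (a ∷ w) (false ∷ u) (suc j) t ne = vertical-old M w u j t ne
vertical-old M (zero ∷ w) (true ∷ u) zero t ne = ⊥-elim (ne refl)
vertical-old M (zero ∷ w) (true ∷ u) (suc j) t ne = vertical-old _ w u j t ne
vertical-old M (suc a ∷ w) (true ∷ u) zero t ne = refl
vertical-old M (suc a ∷ w) (true ∷ u) (suc j) t ne = vertical-old _ w u j t ne

vertical-trichotomy : ∀ M w u → Bounded M w → ∀ j
  → at (vertical M w u) j ≡ 0 ⊎ at (vertical M w u) j ≡ at w j ⊎ M < at (vertical M w u) j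
vertical-trichotomy M [] u bnd j = inj₁ refl
vertical-trichotomy M (a ∷ w) [] bnd j = inj₁ refl
vertical-trichotomy M (a ∷ w) (false ∷ u) bnd zero = inj₁ refl
vertical-trichotomy M (a ∷ w) (false ∷ u) bnd (suc j) =
  vertical-trichotomy M w u (λ j → bnd (suc j)) j
vertical-trichotomy M (zero ∷ w) (true ∷ u) bnd zero = inj₂ (inj₂ ≤-refl)
vertical-trichotomy M (suc a ∷ w) (true ∷ u) bnd zero = inj₂ (inj₁ refl)
vertical-trichotomy M (zero ∷ w) (true ∷ u) bnd (suc j) =
  ⊎-map₂ (⊎-map₂ (≤-<-trans (m≤m⊔n M (suc M)))) (vertical-trichotomy _ w u (bounded-tail zero w (suc M) bnd) j)
vertical-trichotomy M (suc a ∷ w) (true ∷ u) bnd (suc j) =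
  ⊎-map₂ (⊎-map₂ (≤-<-trans (m≤m⊔n M (suc a)))) (vertical-trichotomy _ w u (bounded-tail (suc a) w (suc a) bnd) j)

vertical-fresh : ∀ M w u j → length w ≡ length u → Bounded M w → bitAt u j ≡ true → at w j ≡ 0
               → M < at (vertical M w u) j
vertical-fresh M [] [] j _ _ ()
vertical-fresh M (a ∷ w) (false ∷ u) (suc j) e bnd t z =
  vertical-fresh M w u j (suc-injective e) (λ j → bnd (suc j)) t z
vertical-fresh M (zero ∷ w) (true ∷ u) zero e bnd t z = ≤-refl
vertical-fresh M (zero ∷ w) (true ∷ u) (suc j) e bnd t z =
  ≤-<-trans (m≤m⊔n M (suc M)) (vertical-fresh _ w u j (suc-injective e) (bounded-tail zero w (suc M) bnd) t z)
vertical-fresh M (suc a ∷ w) (true ∷ u) (suc j) e bnd t z =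
  ≤-<-trans (m≤m⊔n M (suc a)) (vertical-fresh _ w u j (suc-injective e) (bounded-tail (suc a) w (suc a) bnd) t z)

-- A fresh letter occurs only once: it exceeds the running maximum, which bounds every
-- letter to its left, and every later fresh letter exceeds it.
vertical-fresh-unique : ∀ M w u j j' → length w ≡ length u → Bounded M w → bitAt u j ≡ true → at w j ≡ 0
                      → at (vertical M w u) j ≡ at (vertical M w u) j' → j ≡ j'
vertical-fresh-unique M [] [] j j' _ _ ()
vertical-fresh-unique M (a ∷ w) (false ∷ u) zero j' e bnd () z eq
vertical-fresh-unique M (a ∷ w) (false ∷ u) (suc j) zero e bnd t z eq =
  ⊥-elim (vertical-selected M w u j (suc-injective e) t eq)
vertical-fresh-unique M (a ∷ w) (false ∷ u) (suc j) (suc j') e bnd t z eq =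
  cong suc (vertical-fresh-unique M w u j j' (suc-injective e) (λ j → bnd (suc j)) t z eq)
vertical-fresh-unique M (zero ∷ w) (true ∷ u) zero zero e bnd t z eq = refl
vertical-fresh-unique M (zero ∷ w) (true ∷ u) zero (suc j') e bnd t z eq
  with vertical-trichotomy (M ⊔ suc M) w u (bounded-tail zero w (suc M) bnd) j'
... | inj₁ x≡0 = ⊥-elim (0≢1+n (trans (sym x≡0) (sym eq)))
... | inj₂ (inj₁ x≡w) = ⊥-elim (1+n≰n (≤-trans (≤-reflexive (trans eq x≡w)) (bnd (suc j'))))
... | inj₂ (inj₂ M'<x) = ⊥-elim (1+n≰n (≤-<-trans (m≤n⊔m M (suc M)) (subst (M ⊔ suc M <_) (sym eq) M'<x)))
vertical-fresh-unique M (zero ∷ w) (true ∷ u) (suc j) zero e bnd t z eq =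
  ⊥-elim (1+n≰n (≤-<-trans (m≤n⊔m M (suc M)) (subst (M ⊔ suc M <_) eq
    (vertical-fresh _ w u j (suc-injective e) (bounded-tail zero w (suc M) bnd) t z))))
vertical-fresh-unique M (zero ∷ w) (true ∷ u) (suc j) (suc j') e bnd t z eq =
  cong suc (vertical-fresh-unique _ w u j j' (suc-injective e) (bounded-tail zero w (suc M) bnd) t z eq)
vertical-fresh-unique M (suc a ∷ w) (true ∷ u) zero j' e bnd t () eq
vertical-fresh-unique M (suc a ∷ w) (true ∷ u) (suc j) zero e bnd t z eq =
  ⊥-elim (1+n≰n (≤-<-trans (m≤n⊔m M (suc a)) (subst (M ⊔ suc a <_) eq
    (vertical-fresh _ w u j (suc-injective e) (bounded-tail (suc a) w (suc a) bnd) t z))))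
vertical-fresh-unique M (suc a ∷ w) (true ∷ u) (suc j) (suc j') e bnd t z eq =
  cong suc (vertical-fresh-unique _ w u j j' (suc-injective e) (bounded-tail (suc a) w (suc a) bnd) t z eq)

-- Linked positions and horizontal components

record LinkStep (x : Word) (j j' : ℕ) : Set where
  constructor linkStep
  field
    ≢0ˡ : at x j ≢ 0
    ≢0ʳ : at x j' ≢ 0
    kind : at x j ≡ at x j' ⊎ (suc j ≡ j' ⊎ suc j' ≡ j)

Linked : Word → ℕ → ℕ → Set
Linked x = Star (LinkStep x)

linkStep-sym : ∀ {x j j'} → LinkStep x j j' → LinkStep x j' j
linkStep-sym (linkStep n n' (inj₁ e)) = linkStep n' n (inj₁ (sym e))
linkStep-sym (linkStep n n' (inj₂ (inj₁ e))) = linkStep n' n (inj₂ (inj₂ e))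
linkStep-sym (linkStep n n' (inj₂ (inj₂ e))) = linkStep n' n (inj₂ (inj₁ e))

linked-sym : ∀ {x j j'} → Linked x j j' → Linked x j' j
linked-sym = reverse linkStep-sym

linked-≢0 : ∀ {x j j'} → Linked x j j' → at x j' ≢ 0 → at x j ≢ 0
linked-≢0 ε ne = ne
linked-≢0 (linkStep n _ _ ◅ _) _ = n

linked-∷ : ∀ a x {j j'} → Linked x j j' → Linked (a ∷ x) (suc j) (suc j')
linked-∷ a x = gmap suc shift
  where
  shift : ∀ {j j'} → LinkStep x j j' → LinkStep (a ∷ x) (suc j) (suc j')
  shift (linkStep n n' (inj₁ e)) = linkStep n n' (inj₁ e)
  shift (linkStep n n' (inj₂ (inj₁ e))) = linkStep n n' (inj₂ (inj₁ (cong suc e)))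
  shift (linkStep n n' (inj₂ (inj₂ e))) = linkStep n n' (inj₂ (inj₂ (cong suc e)))

componentsGo-suc : ∀ cur a x → componentsGo cur (suc a ∷ x) ≡ componentsGo (cur ∷ʳ suc a) x
componentsGo-suc [] a x = refl
componentsGo-suc (_ ∷ _) a x = refl

∷ʳ≢[] : ∀ {A : Set} (xs : List A) (a : A) → xs ∷ʳ a ≢ []
∷ʳ≢[] [] a ()
∷ʳ≢[] (_ ∷ _) a ()

componentsGo-current : ∀ cur x → cur ≢ [] →
  ∃[ c ] (c ∈ componentsGo cur x × cur ⊆ c × (at x 0 ≢ 0 → at x 0 ∈ c))
componentsGo-current [] x ne = ⊥-elim (ne refl)
componentsGo-current cur@(_ ∷ _) [] ne = cur , here refl , (λ m → m) , (λ z → ⊥-elim (z refl))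
componentsGo-current cur@(_ ∷ _) (zero ∷ x) ne = cur , here refl , (λ m → m) , (λ z → ⊥-elim (z refl))
componentsGo-current cur@(_ ∷ _) (suc a ∷ x) ne with componentsGo-current (cur ∷ʳ suc a) x (∷ʳ≢[] cur (suc a))
... | c , c∈ , cur⊆c , _ = c , c∈ , (λ m → cur⊆c (∈-++⁺ˡ m)) , (λ _ → cur⊆c (∈-++⁺ʳ cur (here refl)))

componentsGo-through : ∀ cur x j → at x j ≢ 0 →
  ∃[ c ] (c ∈ componentsGo cur x × at x j ∈ c × (at x (suc j) ≢ 0 → at x (suc j) ∈ c))
componentsGo-through cur [] j ne = ⊥-elim (ne refl)
componentsGo-through cur (zero ∷ x) zero ne = ⊥-elim (ne refl)
componentsGo-through [] (zero ∷ x) (suc j) ne = componentsGo-through [] x j ne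
componentsGo-through (_ ∷ _) (zero ∷ x) (suc j) ne with componentsGo-through [] x j ne
... | c , c∈ , rest = c , there c∈ , rest
componentsGo-through cur (suc a ∷ x) zero ne
  with componentsGo-current (cur ∷ʳ suc a) x (∷ʳ≢[] cur (suc a))
... | c , c∈ , cur⊆c , next =
  c , subst (c ∈_) (sym (componentsGo-suc cur a x)) c∈ , cur⊆c (∈-++⁺ʳ cur (here refl)) , next
componentsGo-through cur (suc a ∷ x) (suc j) ne with componentsGo-through (cur ∷ʳ suc a) x j ne
... | c , c∈ , rest = c , subst (c ∈_) (sym (componentsGo-suc cur a x)) c∈ , rest

component-through : ∀ x j → at x j ≢ 0 →
  ∃[ c ] (c ∈ components x × at x j ∈ c × (at x (suc j) ≢ 0 → at x (suc j) ∈ c))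
component-through = componentsGo-through []

componentsGo-nonempty : ∀ cur x {c} → c ∈ componentsGo cur x → ∃[ a ] a ∈ c
componentsGo-nonempty [] [] ()
componentsGo-nonempty (y ∷ _) [] (here refl) = y , here refl
componentsGo-nonempty [] (zero ∷ x) c∈ = componentsGo-nonempty [] x c∈
componentsGo-nonempty (y ∷ _) (zero ∷ x) (here refl) = y , here refl
componentsGo-nonempty (_ ∷ _) (zero ∷ x) (there c∈) = componentsGo-nonempty [] x c∈
componentsGo-nonempty cur (suc a ∷ x) c∈ =
  componentsGo-nonempty (cur ∷ʳ suc a) x (subst (_ ∈_) (componentsGo-suc cur a x) c∈)

LinkedLetters : Word → Word → Set
LinkedLetters x c = ∃[ j₀ ] (∀ {a} → a ∈ c → ∃[ j ] (at x j ≡ a × a ≢ 0 × Linked x j₀ j))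

-- While a component is being accumulated in cur, the letters it receives from x are
-- linked to position 0 of x.
LinkedFromStart : Word → Word → Word → Set
LinkedFromStart cur x c = ∀ {a} → a ∈ c → a ∈ cur ⊎ ∃[ j ] (at x j ≡ a × a ≢ 0 × Linked x 0 j)

linkedFromStart-[] : ∀ x {c} → LinkedFromStart [] x c ⊎ LinkedLetters x c → LinkedLetters x c
linkedFromStart-[] x (inj₁ f) = 0 , λ m → [ (λ ()) , (λ r → r) ]′ (f m)
linkedFromStart-[] x (inj₂ linked) = linked

linkedLetters-∷ : ∀ a x {c} → LinkedLetters x c → LinkedLetters (a ∷ x) c
linkedLetters-∷ a x (j₀ , f) = suc j₀ , λ m → let j , e , nz , L = f m in suc j , e , nz , linked-∷ a x L

componentsGo-linked : ∀ cur x → (∀ {a} → a ∈ cur → a ≢ 0) → ∀ {c} → c ∈ componentsGo cur x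
                    → LinkedFromStart cur x c ⊎ LinkedLetters x c
componentsGo-linked [] [] nz ()
componentsGo-linked (_ ∷ _) [] nz (here refl) = inj₁ inj₁
componentsGo-linked [] (zero ∷ x) nz c∈ =
  inj₂ (linkedLetters-∷ zero x (linkedFromStart-[] x (componentsGo-linked [] x (λ ()) c∈)))
componentsGo-linked (_ ∷ _) (zero ∷ x) nz (here refl) = inj₁ inj₁
componentsGo-linked (_ ∷ _) (zero ∷ x) nz (there c∈) =
  inj₂ (linkedLetters-∷ zero x (linkedFromStart-[] x (componentsGo-linked [] x (λ ()) c∈)))
componentsGo-linked cur (suc a ∷ x) nz {c} c∈
  with componentsGo-linked (cur ∷ʳ suc a) x nz′ (subst (c ∈_) (componentsGo-suc cur a x) c∈)
  where
  nz′ : ∀ {b} → b ∈ cur ∷ʳ suc a → b ≢ 0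
  nz′ m with ∈-++⁻ cur m
  ... | inj₁ m′ = nz m′
  ... | inj₂ (here refl) = λ ()
... | inj₂ s = inj₂ (linkedLetters-∷ (suc a) x s)
... | inj₁ f = inj₁ g
  where
  g : LinkedFromStart cur (suc a ∷ x) c
  g m with f m
  ... | inj₂ (j , e , nz , L) =
        inj₂ (suc j , e , nz , linkStep (λ ()) (linked-≢0 L (subst (_≢ 0) (sym e) nz)) (inj₂ (inj₁ refl))
                               ◅ linked-∷ (suc a) x L)
  ... | inj₁ m′ with ∈-++⁻ cur m′
  ... | inj₁ m″ = inj₁ m″
  ... | inj₂ (here refl) = inj₂ (0 , refl , (λ ()) , ε)

component-linked : ∀ x {c} → c ∈ components x → LinkedLetters x c
component-linked x c∈ = linkedFromStart-[] x (componentsGo-linked [] x (λ ()) c∈)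

-- Linked classes of components

filterB⁻ : ∀ (p : Word → Bool) cs {c} → c ∈ filterB p cs → c ∈ cs × p c ≡ true
filterB⁻ p (d ∷ cs) m with p d in e
filterB⁻ p (d ∷ cs) (here refl) | true = here refl , e
filterB⁻ p (d ∷ cs) (there m) | true = map₁ there (filterB⁻ p cs m)
filterB⁻ p (d ∷ cs) m | false = map₁ there (filterB⁻ p cs m)

filterB⁺ : ∀ (p : Word → Bool) cs {c} → c ∈ cs → p c ≡ true → c ∈ filterB p cs
filterB⁺ p (d ∷ cs) (here refl) e rewrite e = here refl
filterB⁺ p (d ∷ cs) (there m) e with p d
... | true = there (filterB⁺ p cs m e)
... | false = filterB⁺ p cs m e

length-filterB≤ : ∀ (p : Word → Bool) cs → length (filterB p cs) ≤ length cs
length-filterB≤ p [] = z≤n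
length-filterB≤ p (d ∷ cs) with p d
... | true = s≤s (length-filterB≤ p cs)
... | false = m≤n⇒m≤1+n (length-filterB≤ p cs)

module _ (p q : Word → Bool) where

  length-filterB-mono : ∀ cs → (∀ {c} → c ∈ cs → p c ≡ true → q c ≡ true)
                      → length (filterB p cs) ≤ length (filterB q cs)
  length-filterB-mono [] p⇒q = z≤n
  length-filterB-mono (d ∷ cs) p⇒q with p d in pd | q d in qd
  ... | true | true = s≤s (length-filterB-mono cs (λ m → p⇒q (there m)))
  ... | true | false with trans (sym (p⇒q (here refl) pd)) qd
  ... | ()
  length-filterB-mono (d ∷ cs) p⇒q | false | true = m≤n⇒m≤1+n (length-filterB-mono cs (λ m → p⇒q (there m)))
  length-filterB-mono (d ∷ cs) p⇒q | false | false = length-filterB-mono cs (λ m → p⇒q (there m))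

  length-filterB-≡⇒ : ∀ cs → (∀ {c} → c ∈ cs → p c ≡ true → q c ≡ true)
                    → length (filterB p cs) ≡ length (filterB q cs) → ∀ {c} → c ∈ cs → q c ≡ true → p c ≡ true
  length-filterB-≡⇒ (d ∷ cs) p⇒q same m qc with p d in pd | q d in qd
  length-filterB-≡⇒ (d ∷ cs) p⇒q same (here refl) qc | true | _ = pd
  length-filterB-≡⇒ (d ∷ cs) p⇒q same (there m) qc | true | true =
    length-filterB-≡⇒ cs (λ m → p⇒q (there m)) (suc-injective same) m qc
  length-filterB-≡⇒ (d ∷ cs) p⇒q same m qc | true | false with trans (sym (p⇒q (here refl) pd)) qd
  ... | ()
  length-filterB-≡⇒ (d ∷ cs) p⇒q same m qc | false | true =
    ⊥-elim (1+n≰n (≤-trans (s≤s (length-filterB-mono cs (λ m → p⇒q (there m)))) (≤-reflexive (sym same))))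
  length-filterB-≡⇒ (d ∷ cs) p⇒q same (here refl) qc | false | false with trans (sym qc) qd
  ... | ()
  length-filterB-≡⇒ (d ∷ cs) p⇒q same (there m) qc | false | false =
    length-filterB-≡⇒ cs (λ m → p⇒q (there m)) same m qc

iter-suc : ∀ n (f : Word → Word) S → iter (suc n) f S ≡ f (iter n f S)
iter-suc zero f S = refl
iter-suc (suc n) f S = iter-suc n f (f S)

module Classes (cs : List Word) (nonempty : ∀ {c} → c ∈ cs → ∃[ a ] a ∈ c) where

  record ShareComponent (a a' : ℕ) : Set where
    constructor shareComponent
    field
      {component} : Word
      component∈ : component ∈ cs
      ∈component : a ∈ component
      ∈component′ : a' ∈ component

  shareComponent-sym : ∀ {a a'} → ShareComponent a a' → ShareComponent a' a
  shareComponent-sym (shareComponent c∈ a∈ a'∈) = shareComponent c∈ a'∈ a∈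

  LetterLinked : ℕ → ℕ → Set
  LetterLinked = Star ShareComponent

  Connected : Word → Set
  Connected S = ∀ {a a'} → a ∈ S → a' ∈ S → LetterLinked a a'

  Saturated : Word → Set
  Saturated S = ∀ {d} → d ∈ cs → ∀ {e} → e ∈ d → e ∈ S → d ⊆ S

  saturated-letterLinked : ∀ {S} → Saturated S → ∀ {a a'} → a ∈ S → LetterLinked a a' → a' ∈ S
  saturated-letterLinked sat a∈S ε = a∈S
  saturated-letterLinked sat a∈S (shareComponent d∈ a∈d a'∈d ◅ rest) =
    saturated-letterLinked sat (sat d∈ a∈d a∈S a'∈d) rest

  ⊆-grow : ∀ S → S ⊆ grow cs S
  ⊆-grow S = ∈-++⁺ˡ

  meeting-⊆-grow : ∀ S {d} → d ∈ cs → intersects d S ≡ true → d ⊆ grow cs S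
  meeting-⊆-grow S d∈ e m = ∈-++⁺ʳ S (∈-concat⁺′ m (filterB⁺ (λ c → intersects c S) cs d∈ e))

  ∈-grow⁻ : ∀ S {a} → a ∈ grow cs S → a ∈ S ⊎ ∃[ d ] (d ∈ cs × (∃[ e ] (e ∈ d × e ∈ S)) × a ∈ d)
  ∈-grow⁻ S m with ∈-++⁻ S m
  ... | inj₁ m′ = inj₁ m′
  ... | inj₂ m′ with ∈-concat⁻′ (filterB (λ c → intersects c S) cs) m′
  ... | d , a∈d , d∈ with filterB⁻ (λ c → intersects c S) cs d∈
  ... | d∈cs , meets = inj₂ (d , d∈cs , intersects⁻ d S meets , a∈d)

  grow-connected : ∀ S → Connected S → Connected (grow cs S)
  grow-connected S conn m m′ with ∈-grow⁻ S m | ∈-grow⁻ S m′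
  ... | inj₁ p | inj₁ q = conn p q
  ... | inj₂ (d , d∈ , (e , e∈d , e∈S) , a∈d) | inj₁ q = shareComponent d∈ a∈d e∈d ◅ conn e∈S q
  ... | inj₁ p | inj₂ (d , d∈ , (e , e∈d , e∈S) , a∈d) = conn p e∈S ◅◅ (shareComponent d∈ e∈d a∈d ◅ ε)
  ... | inj₂ (d , d∈ , (e , e∈d , e∈S) , a∈d) | inj₂ (d' , d'∈ , (e' , e'∈d' , e'∈S) , a'∈d') =
        shareComponent d∈ a∈d e∈d ◅ (conn e∈S e'∈S ◅◅ (shareComponent d'∈ e'∈d' a'∈d' ◅ ε))

  iter-grow-connected : ∀ n S → Connected S → Connected (iter n (grow cs) S)
  iter-grow-connected zero S conn = conn
  iter-grow-connected (suc n) S conn = iter-grow-connected n (grow cs S) (grow-connected S conn)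

  ⊆-iter-grow : ∀ n S → S ⊆ iter n (grow cs) S
  ⊆-iter-grow zero S m = m
  ⊆-iter-grow (suc n) S m = ⊆-iter-grow n (grow cs S) (⊆-grow S m)

  meetCount : Word → ℕ
  meetCount S = length (filterB (λ d → intersects d S) cs)

  saturated-grow : ∀ S → Saturated S → Saturated (grow cs S)
  saturated-grow S sat d∈ e∈d e∈ a∈d with ∈-grow⁻ S e∈
  ... | inj₁ e∈S = ⊆-grow S (sat d∈ e∈d e∈S a∈d)
  ... | inj₂ (d′ , d′∈ , (f , f∈d′ , f∈S) , e∈d′) =
    ⊆-grow S (sat d∈ e∈d (sat d′∈ f∈d′ f∈S e∈d′) a∈d)

  -- Each round of growth either saturates or meets a new component, and there are only
  -- length cs components.
  iter-grow-saturates : ∀ c → c ∈ cs → ∀ n → Saturated (iter n (grow cs) c) ⊎ suc n ≤ meetCount (iter n (grow cs) c)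
  iter-grow-saturates c c∈ zero with nonempty c∈
  ... | a , a∈c = inj₂ (∈-length (filterB⁺ (λ d → intersects d c) cs c∈ (intersects⁺ a∈c a∈c)))
  iter-grow-saturates c c∈ (suc n) rewrite iter-suc n (grow cs) c with iter-grow-saturates c c∈ n
  ... | inj₁ sat = inj₁ (saturated-grow _ sat)
  ... | inj₂ grows with m≤n⇒m<n∨m≡n (length-filterB-mono _ _ cs (λ {d} _ → intersects-monoʳ d (⊆-grow S)))
    where S = iter n (grow cs) c
  ... | inj₁ more = inj₂ (≤-trans (s≤s grows) more)
  ... | inj₂ same = inj₁ sat
    where
    S = iter n (grow cs) c
    sat : Saturated (grow cs S)
    sat {d} d∈ e∈d e∈ = meeting-⊆-grow S d∈
      (length-filterB-≡⇒ _ _ cs (λ {d} _ → intersects-monoʳ d (⊆-grow S)) same d∈ (intersects⁺ e∈d e∈))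

  class-saturated : ∀ c → c ∈ cs → Saturated (classLetters cs c)
  class-saturated c c∈ with iter-grow-saturates c c∈ (length cs)
  ... | inj₁ sat = sat
  ... | inj₂ too-many = ⊥-elim (1+n≰n (≤-trans too-many (length-filterB≤ _ cs)))

  class-connected : ∀ c → c ∈ cs → Connected (classLetters cs c)
  class-connected c c∈ = iter-grow-connected (length cs) c (λ m m′ → shareComponent c∈ m m′ ◅ ε)

  ⊆-class : ∀ c → c ⊆ classLetters cs c
  ⊆-class c = ⊆-iter-grow (length cs) c

  LabelTable : Set
  LabelTable = List (Word × ℕ)

  record LabelTableInvariant (lab : LabelTable) (n : ℕ) : Set where
    field
      saturated-connected : ∀ {e} → e ∈ lab → Saturated (proj₁ e) × Connected (proj₁ e)
      label-in : ∀ {e} → e ∈ lab → proj₂ e ≢ 0 × proj₂ e ≤ n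
      label-unique : ∀ {e e'} → e ∈ lab → e' ∈ lab → proj₂ e ≡ proj₂ e' → e ≡ e'

  record LabelGoSpec (lab : LabelTable) (rest : List Word) (out : LabelTable) : Set where
    field
      {bound} : ℕ
      invariant : LabelTableInvariant out bound
      keeps : lab ⊆ out
      covers : ∀ {c} → c ∈ rest → ∃[ e ] (e ∈ out × intersects c (proj₁ e) ≡ true)

  snoc-class-invariant : ∀ {lab n c} → c ∈ cs → LabelTableInvariant lab n
                       → LabelTableInvariant (lab ∷ʳ (classLetters cs c , suc n)) (suc n)
  snoc-class-invariant {lab} {n} {c} c∈ inv = record
    { saturated-connected = sat-conn ; label-in = label-in′ ; label-unique = unique }
    where
    open LabelTableInvariant inv
    sat-conn : ∀ {e} → e ∈ lab ∷ʳ (classLetters cs c , suc n) → Saturated (proj₁ e) × Connected (proj₁ e)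
    sat-conn m with ∈-++⁻ lab m
    ... | inj₁ m′ = saturated-connected m′
    ... | inj₂ (here refl) = class-saturated c c∈ , class-connected c c∈
    label-in′ : ∀ {e} → e ∈ lab ∷ʳ (classLetters cs c , suc n) → proj₂ e ≢ 0 × proj₂ e ≤ suc n
    label-in′ m with ∈-++⁻ lab m
    ... | inj₁ m′ = proj₁ (label-in m′) , m≤n⇒m≤1+n (proj₂ (label-in m′))
    ... | inj₂ (here refl) = (λ ()) , ≤-refl
    unique : ∀ {e e'} → e ∈ lab ∷ʳ (classLetters cs c , suc n) → e' ∈ lab ∷ʳ (classLetters cs c , suc n)
           → proj₂ e ≡ proj₂ e' → e ≡ e'
    unique m m' same with ∈-++⁻ lab m | ∈-++⁻ lab m'
    ... | inj₁ m₁ | inj₁ m₂ = label-unique m₁ m₂ same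
    ... | inj₁ m₁ | inj₂ (here refl) = ⊥-elim (1+n≰n (≤-trans (≤-reflexive (sym same)) (proj₂ (label-in m₁))))
    ... | inj₂ (here refl) | inj₁ m₂ = ⊥-elim (1+n≰n (≤-trans (≤-reflexive same) (proj₂ (label-in m₂))))
    ... | inj₂ (here refl) | inj₂ (here refl) = refl

  labelGo-spec : ∀ lab n rest → rest ⊆ cs → LabelTableInvariant lab n → LabelGoSpec lab rest (labelGo cs lab n rest)
  labelGo-spec lab n [] _ inv = record { invariant = inv ; keeps = λ m → m ; covers = λ () }
  labelGo-spec lab n (c ∷ rest) rest⊆ inv with any (λ p → intersects c (proj₁ p)) lab in meets
  ... | true = record { invariant = invariant ; keeps = keeps ; covers = covers′ }
    where
    open LabelGoSpec (labelGo-spec lab n rest (λ m → rest⊆ (there m)) inv)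
    covers′ : ∀ {c'} → c' ∈ c ∷ rest → ∃[ e ] (e ∈ labelGo cs lab n rest × intersects c' (proj₁ e) ≡ true)
    covers′ (here refl) with any≡true⁻ (λ p → intersects c (proj₁ p)) lab meets
    ... | e , e∈ , c-meets-e = e , keeps e∈ , c-meets-e
    covers′ (there m) = covers m
  ... | false = record { invariant = invariant ; keeps = λ m → keeps (∈-++⁺ˡ m) ; covers = covers′ }
    where
    c∈ = rest⊆ (here refl)
    lab₁ = lab ∷ʳ (classLetters cs c , suc n)
    open LabelGoSpec (labelGo-spec lab₁ (suc n) rest (λ m → rest⊆ (there m)) (snoc-class-invariant c∈ inv))
    covers′ : ∀ {c'} → c' ∈ c ∷ rest → ∃[ e ] (e ∈ labelGo cs lab₁ (suc n) rest × intersects c' (proj₁ e) ≡ true)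
    covers′ (here refl) with nonempty c∈
    ... | a , a∈c = (classLetters cs c , suc n) , keeps (∈-++⁺ʳ lab (here refl)) , intersects⁺ a∈c (⊆-class c a∈c)
    covers′ (there m) = covers m

  labels : LabelTable
  labels = labelGo cs [] 0 cs

  labels-spec : LabelGoSpec [] cs labels
  labels-spec = labelGo-spec [] 0 cs (λ m → m) record { saturated-connected = λ () ; label-in = λ () ; label-unique = λ () }

labelOf-≢0 : ∀ (t : List (Word × ℕ)) a → (∀ {e} → e ∈ t → proj₂ e ≢ 0)
           → ∀ {e} → e ∈ t → a ∈ proj₁ e → labelOf t a ≢ 0
labelOf-≢0 ((S , k) ∷ t) a nz m a∈ with member a S in a∈S
... | true = nz (here refl)
labelOf-≢0 ((S , k) ∷ t) a nz (here refl) a∈ | false = ⊥-elim (member≡false⇒∉ a∈S a∈)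
labelOf-≢0 ((S , k) ∷ t) a nz (there m) a∈ | false = labelOf-≢0 t a (λ m' → nz (there m')) m a∈

labelOf-cong : ∀ (t : List (Word × ℕ)) a a'
             → (∀ {e} → e ∈ t → (a ∈ proj₁ e → a' ∈ proj₁ e) × (a' ∈ proj₁ e → a ∈ proj₁ e))
             → labelOf t a ≡ labelOf t a'
labelOf-cong [] a a' same = refl
labelOf-cong ((S , k) ∷ t) a a' same rewrite member-cong {a} {a'} {S} (proj₁ (same (here refl))) (proj₂ (same (here refl)))
  with member a' S
... | true = refl
... | false = labelOf-cong t a a' (λ m → same (there m))

labelOf-entry : ∀ (t : List (Word × ℕ)) a → labelOf t a ≢ 0 → ∃[ e ] (e ∈ t × a ∈ proj₁ e × proj₂ e ≡ labelOf t a)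
labelOf-entry [] a nz = ⊥-elim (nz refl)
labelOf-entry ((S , k) ∷ t) a nz with member a S in a∈S
... | true = (S , k) , here refl , member⁻ a S a∈S , refl
... | false with labelOf-entry t a nz
... | e , e∈ , a∈e , k≡ = e , there e∈ , a∈e , k≡

-- The horizontal step

module Horizontal (x : Word) where
  open Classes (components x) (componentsGo-nonempty [] x)
  open LabelGoSpec labels-spec
  open LabelTableInvariant invariant

  labelLetter : ℕ → ℕ
  labelLetter a = if a ≡ᵇ 0 then 0 else labelOf labels a

  horizontal-at : ∀ j → at (horizontal x) j ≡ labelLetter (at x j)
  horizontal-at = at-map labelLetter refl x

  labelLetter-≢0 : ∀ a → a ≢ 0 → labelLetter a ≡ labelOf labels a
  labelLetter-≢0 zero ne = ⊥-elim (ne refl)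
  labelLetter-≢0 (suc a) ne = refl

  at-horizontal : ∀ j → at x j ≢ 0 → at (horizontal x) j ≡ labelOf labels (at x j)
  at-horizontal j ne = trans (horizontal-at j) (labelLetter-≢0 _ ne)

  horizontal-≡0 : ∀ j → at x j ≡ 0 → at (horizontal x) j ≡ 0
  horizontal-≡0 j e = trans (horizontal-at j) (cong labelLetter e)

  horizontal-≢0 : ∀ j → at x j ≢ 0 → at (horizontal x) j ≢ 0
  horizontal-≢0 j ne with component-through x j ne
  ... | c , c∈ , a∈c , _ with covers c∈
  ... | e , e∈ , c-meets-e with intersects⁻ c (proj₁ e) c-meets-e
  ... | b , b∈c , b∈e = λ z → labelOf-≢0 labels (at x j) (λ m → proj₁ (label-in m)) e∈
                                (proj₁ (saturated-connected e∈) c∈ b∈c b∈e a∈c) (trans (sym (at-horizontal j ne)) z)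

  shareComponent⇒label-≡ : ∀ {a a'} → ShareComponent a a' → labelOf labels a ≡ labelOf labels a'
  shareComponent⇒label-≡ sc = labelOf-cong labels _ _ λ m →
    let sat = proj₁ (saturated-connected m) in
    (λ p → saturated-letterLinked sat p (sc ◅ ε)) , (λ p → saturated-letterLinked sat p (shareComponent-sym sc ◅ ε))

  -- horizontal neighbours lie in one component
  linkStep⇒horizontal-≡ : ∀ {j j'} → LinkStep x j j' → at (horizontal x) j ≡ at (horizontal x) j'
  linkStep⇒horizontal-≡ {j} {j'} (linkStep n n' (inj₁ e)) =
    trans (horizontal-at j) (trans (cong labelLetter e) (sym (horizontal-at j')))
  linkStep⇒horizontal-≡ {j} {j'} (linkStep n n' (inj₂ (inj₁ refl))) with component-through x j n
  ... | c , c∈ , a∈c , next =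
    trans (at-horizontal j n) (trans (shareComponent⇒label-≡ (shareComponent c∈ a∈c (next n'))) (sym (at-horizontal j' n')))
  linkStep⇒horizontal-≡ {j} {j'} (linkStep n n' (inj₂ (inj₂ refl))) with component-through x j' n'
  ... | c , c∈ , a∈c , next =
    trans (at-horizontal j n) (trans (shareComponent⇒label-≡ (shareComponent c∈ (next n) a∈c)) (sym (at-horizontal j' n')))

  linked⇒horizontal-≡ : ∀ {j j'} → Linked x j j' → at (horizontal x) j ≡ at (horizontal x) j'
  linked⇒horizontal-≡ ε = refl
  linked⇒horizontal-≡ (s ◅ p) = trans (linkStep⇒horizontal-≡ s) (linked⇒horizontal-≡ p)

  letterLinked⇒linked : ∀ {a a'} → LetterLinked a a' → ∀ j → at x j ≡ a → a ≢ 0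
                      → ∃[ j' ] (at x j' ≡ a' × Linked x j j')
  letterLinked⇒linked ε j e nz = j , e , ε
  letterLinked⇒linked (shareComponent c∈ a∈c b∈c ◅ rest) j e nz with component-linked x c∈
  ... | j₀ , linked with linked a∈c | linked b∈c
  ... | p , ep , nzp , Lp | p' , ep' , nzp' , Lp' with letterLinked⇒linked rest p' ep' nzp'
  ... | q , eq , Lq =
    q , eq , (linkStep (subst (_≢ 0) (sym e) nz) (subst (_≢ 0) (sym ep) nz) (inj₁ (trans e (sym ep)))
              ◅ (linked-sym Lp ◅◅ Lp')) ◅◅ Lq

  -- equal labels come from one entry of the label table, whose letters are connected
  horizontal-≡⇒linked : ∀ j j' → at x j ≢ 0 → at x j' ≢ 0 → at (horizontal x) j ≡ at (horizontal x) j' → Linked x j j'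
  horizontal-≡⇒linked j j' n n' eq
    with labelOf-entry labels (at x j) (λ z → horizontal-≢0 j n (trans (at-horizontal j n) z))
       | labelOf-entry labels (at x j') (λ z → horizontal-≢0 j' n' (trans (at-horizontal j' n') z))
  ... | e , e∈ , a∈e , k≡ | e' , e'∈ , a'∈e' , k'≡
    with label-unique e∈ e'∈ (trans k≡ (trans (sym (at-horizontal j n)) (trans eq (trans (at-horizontal j' n') (sym k'≡)))))
  ... | refl with letterLinked⇒linked (proj₂ (saturated-connected e∈) a∈e a'∈e') j refl n
  ... | q , eq' , Lq = Lq ◅◅ (linkStep (subst (_≢ 0) (sym eq') n') n' (inj₁ eq') ◅ ε)

drop-∷ : ∀ {A : Set} {d : A} k xs {y ys} → drop k xs ≡ y ∷ ys → nthOr d xs k ≡ y × drop (suc k) xs ≡ ys × k < length xs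
drop-∷ zero (x ∷ xs) refl = refl , refl , s≤s z≤n
drop-∷ (suc k) (x ∷ xs) e with drop-∷ k xs e
... | at-k , rest , k< = at-k , rest , s≤s k<

drop-[] : ∀ {A : Set} k (xs : List A) → drop k xs ≡ [] → k ≤ length xs → k ≡ length xs
drop-[] zero [] _ _ = refl
drop-[] (suc k) (x ∷ xs) e (s≤s k≤) = cong suc (drop-[] k xs e k≤)

headB-bitAt : ∀ u → headB u ≡ bitAt u 0
headB-bitAt [] = refl
headB-bitAt (x ∷ u) = refl

lastB-bitAt : ∀ u → lastB u ≡ bitAt u (pred (length u))
lastB-bitAt [] = refl
lastB-bitAt (x ∷ []) = refl
lastB-bitAt (x ∷ y ∷ t) = lastB-bitAt (y ∷ t)

selectedLetters⁻ : ∀ w u {a} → a ∈ selectedLetters w u → ∃[ j ] (bitAt u j ≡ true × at w j ≡ a)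
selectedLetters⁻ (a ∷ w) (true ∷ u) (here refl) = 0 , refl , refl
selectedLetters⁻ (a ∷ w) (true ∷ u) (there m) with selectedLetters⁻ w u m
... | j , uj , wj = suc j , uj , wj
selectedLetters⁻ (a ∷ w) (false ∷ u) m with selectedLetters⁻ w u m
... | j , uj , wj = suc j , uj , wj

selectedLetters⁺ : ∀ w u j → bitAt u j ≡ true → j < length w → at w j ∈ selectedLetters w u
selectedLetters⁺ (a ∷ w) (true ∷ u) zero e lt = here refl
selectedLetters⁺ (a ∷ w) (true ∷ u) (suc j) e (s≤s lt) = there (selectedLetters⁺ w u j e lt)
selectedLetters⁺ (a ∷ w) (false ∷ u) (suc j) e (s≤s lt) = selectedLetters⁺ w u j e lt

EveryLetterContinues : Word → List Bool → Set
EveryLetterContinues w u = ∀ j → at w j ≢ 0 → ∃[ j' ] (bitAt u j' ≡ true × at w j' ≡ at w j)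

transitionDefined⁻ : ∀ w u → transitionDefined w u ≡ true → EveryLetterContinues w u
transitionDefined⁻ w u td j ne
  with all≡true⁻ (λ a → (a ≡ᵇ 0) ∨ member a (selectedLetters w u)) w td (at-∈ w j ne)
... | e rewrite ≢⇒≡ᵇ≡false (at w j) 0 ne = selectedLetters⁻ w u (member⁻ (at w j) (selectedLetters w u) e)

transitionDefined⁺ : ∀ w u → EveryLetterContinues w u → transitionDefined w u ≡ true
transitionDefined⁺ w u continues = all≡true⁺ _ w ok
  where
  ok : ∀ {a} → a ∈ w → ((a ≡ᵇ 0) ∨ member a (selectedLetters w u)) ≡ true
  ok {zero} _ = refl
  ok {suc a} m with ∈⇒at m
  ... | j , wj , _ with continues j (λ z → 0≢1+n (trans (sym z) wj))
  ... | j' , uj' , wj' = subst (λ z → member z (selectedLetters w u) ≡ true) (trans wj' wj)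
    (member⁺ (selectedLetters⁺ w u j' uj' (nthOr≢default⇒<length w j' (λ z → 0≢1+n (trans (sym z) (trans wj' wj))))))

δ-defined : ∀ w l r u → transitionDefined w u ≡ true
          → δ (w , l , r) u ≡ just (canon (horizontal (vertical (maxLetter w) w u)) , l ∨ headB u , r ∨ lastB u)
δ-defined w l r u e rewrite e = refl

isAccepting⁻ : ∀ w {l r} → IsAccepting (w , l , r) → all (λ a → a ≤ᵇ 1) w ≡ true × l ≡ true × r ≡ true
isAccepting⁻ w {l} {r} accepting with ∧≡true⁻ (all (λ a → a ≤ᵇ 1) w) (l ∧ r) accepting
... | letters≤1 , l∧r = letters≤1 , ∧≡true⁻ l r l∧r

isAccepting⁺ : ∀ w {l r} → all (λ a → a ≤ᵇ 1) w ≡ true → l ≡ true → r ≡ true → IsAccepting (w , l , r)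
isAccepting⁺ w letters≤1 l≡true r≡true = cong₂ _∧_ letters≤1 (cong₂ _∧_ l≡true r≡true)

-- Connectivity inside the first rows of a grid

Pos : Set
Pos = ℕ × ℕ

Adj : Pos → Pos → Set
Adj (i , j) (i' , j') = (i ≡ i' × (suc j ≡ j' ⊎ suc j' ≡ j)) ⊎ (j ≡ j' × (suc i ≡ i' ⊎ suc i' ≡ i))

adj-sym : ∀ {c d} → Adj c d → Adj d c
adj-sym (inj₁ (e , inj₁ x)) = inj₁ (sym e , inj₂ x)
adj-sym (inj₁ (e , inj₂ x)) = inj₁ (sym e , inj₁ x)
adj-sym (inj₂ (e , inj₁ x)) = inj₂ (sym e , inj₂ x)
adj-sym (inj₂ (e , inj₂ x)) = inj₂ (sym e , inj₁ x)

module Grid (b : ℕ) (R : List (List Bool)) where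

  sel : ℕ → ℕ → Bool
  sel i j = bitAt (rowAt R i) j

  Sel : Pos → Set
  Sel (i , j) = sel i j ≡ true

  record StepBelow (k : ℕ) (c d : Pos) : Set where
    constructor stepBelow
    field
      sel-c : Sel c
      sel-d : Sel d
      adj : Adj c d
      c<k : proj₁ c < k
      d<k : proj₁ d < k

  ConnectedBelow : ℕ → Pos → Pos → Set
  ConnectedBelow k = Star (StepBelow k)

  stepBelow-sym : ∀ {k c d} → StepBelow k c d → StepBelow k d c
  stepBelow-sym (stepBelow sc sd adj c<k d<k) = stepBelow sd sc (adj-sym adj) d<k c<k

  connectedBelow-sym : ∀ {k c d} → ConnectedBelow k c d → ConnectedBelow k d c
  connectedBelow-sym = reverse stepBelow-sym

  connectedBelow-mono : ∀ {k k'} → k ≤ k' → ∀ {c d} → ConnectedBelow k c d → ConnectedBelow k' c d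
  connectedBelow-mono k≤k' = gmap (λ c → c) λ (stepBelow sc sd adj c<k d<k) →
    stepBelow sc sd adj (≤-trans c<k k≤k') (≤-trans d<k k≤k')

  crossing : ∀ K k {i j d} → i < k → k ≤ proj₁ d → ConnectedBelow K (i , j) d
           → ∃[ p ] (sel (pred k) p ≡ true × sel k p ≡ true × ConnectedBelow k (i , j) (pred k , p))
  crossing K k i<k k≤d ε = ⊥-elim (1+n≰n (≤-trans i<k k≤d))
  crossing K k {i} {j} i<k k≤d (_◅_ {j = (i₁ , j₁)} (stepBelow s s₁ adj _ _) rest) with i₁ <? k
  ... | yes i₁<k with crossing K k i₁<k k≤d rest
  ... | p , above , below , C = p , above , below , stepBelow s s₁ adj i<k i₁<k ◅ C
  crossing K k {i} {j} i<k k≤d (_◅_ {j = (i₁ , j₁)} (stepBelow s s₁ adj _ _) rest) | no i₁≮k with adj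
  ... | inj₁ (refl , _) = ⊥-elim (i₁≮k i<k)
  ... | inj₂ (refl , inj₂ refl) = ⊥-elim (i₁≮k (≤-trans (n≤1+n _) i<k))
  ... | inj₂ (refl , inj₁ refl) with ≤-antisym i<k (≮⇒≥ i₁≮k)
  ... | refl = j , s , s₁ , ε

  -- The state after reading the first k rows; row k - 1 is the last one read.
  record RowInvariant (k : ℕ) (w : Word) (l r : Bool) : Set where
    field
      length-w : length w ≡ b
      zeros⊎one : (∀ j → at w j ≡ 0) ⊎ (∃[ j ] at w j ≡ 1)
      sel⇒≢0 : ∀ i j → suc i ≡ k → sel i j ≡ true → at w j ≢ 0
      ≢0⇒sel : ∀ j → at w j ≢ 0 → ∃[ i ] (suc i ≡ k × sel i j ≡ true)
      same-letter⇒connected : ∀ i j j' → suc i ≡ k → sel i j ≡ true → sel i j' ≡ true → at w j ≡ at w j'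
                            → ConnectedBelow k (i , j) (i , j')
      connected⇒same-letter : ∀ i j j' → suc i ≡ k → ConnectedBelow k (i , j) (i , j') → at w j ≡ at w j'
      reaches-last-row : ∀ i j → i < k → sel i j ≡ true
                       → ∃[ j' ] (sel (pred k) j' ≡ true × ConnectedBelow k (i , j) (pred k , j'))
      l⇒left : l ≡ true → ∃[ i ] (i < k × sel i 0 ≡ true)
      left⇒l : ∀ i → i < k → sel i 0 ≡ true → l ≡ true
      r⇒right : r ≡ true → ∃[ i ] (i < k × sel i (pred b) ≡ true)
      right⇒r : ∀ i → i < k → sel i (pred b) ≡ true → r ≡ true

  initial-invariant : RowInvariant 0 (replicate b 0) false false
  initial-invariant = record
    { length-w = length-replicate b ; zeros⊎one = inj₁ (at-replicate-0 b)
    ; sel⇒≢0 = λ _ _ () ; ≢0⇒sel = λ j ne → ⊥-elim (ne (at-replicate-0 b j))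
    ; same-letter⇒connected = λ _ _ _ () ; connected⇒same-letter = λ _ _ _ () ; reaches-last-row = λ _ _ ()
    ; l⇒left = λ () ; left⇒l = λ _ () ; r⇒right = λ () ; right⇒r = λ _ () }

  module Transition (k : ℕ) (w : Word) (l r : Bool) (inv : RowInvariant k w l r)
                    (row-length : length (rowAt R k) ≡ b) (continues : EveryLetterContinues w (rowAt R k)) where
    open RowInvariant inv
    u = rowAt R k
    M = maxLetter w
    x = vertical M w u
    w' = canon (horizontal x)
    l' = l ∨ headB u
    r' = r ∨ lastB u
    open Horizontal x using (horizontal-≢0; horizontal-≡0; linked⇒horizontal-≡; horizontal-≡⇒linked)

    length-w≡u : length w ≡ length u
    length-w≡u = trans length-w (sym row-length)

    x≢0 : ∀ j → bitAt u j ≡ true → at x j ≢ 0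
    x≢0 j = vertical-selected M w u j length-w≡u

    x≢0⇒sel : ∀ j → at x j ≢ 0 → bitAt u j ≡ true
    x≢0⇒sel j ne with bitAt u j in e
    ... | true = refl
    ... | false = ⊥-elim (ne (vertical-unselected M w u j e))

    w'≢0 : ∀ j → bitAt u j ≡ true → at w' j ≢ 0
    w'≢0 j t z = horizontal-≢0 j (x≢0 j t) (canon-≡0⁻ (horizontal x) j z)

    w'≢0⇒sel : ∀ j → at w' j ≢ 0 → bitAt u j ≡ true
    w'≢0⇒sel j ne with bitAt u j in e
    ... | true = refl
    ... | false = ⊥-elim (ne (canon-≡0⁺ (horizontal x) j (horizontal-≡0 j (vertical-unselected M w u j e))))

    -- A link through an old letter a goes up to row k - 1, where the two cells carrying a
    -- are connected by the invariant; a fresh letter occurs once.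
    linkStep⇒connected : ∀ {j j'} → LinkStep x j j' → ConnectedBelow (suc k) (k , j) (k , j')
    linkStep⇒connected {j} {j'} (linkStep n n' (inj₂ h)) =
      stepBelow (x≢0⇒sel j n) (x≢0⇒sel j' n') (inj₁ (refl , h)) ≤-refl ≤-refl ◅ ε
    linkStep⇒connected {j} {j'} (linkStep n n' (inj₁ e)) with at w j ≟ 0 | at w j' ≟ 0
    ... | yes z | _ = subst (λ t → ConnectedBelow (suc k) (k , j) (k , t))
                            (vertical-fresh-unique M w u j j' length-w≡u (maxLetter-bounded w) (x≢0⇒sel j n) z e) ε
    ... | no _ | yes z = subst (λ t → ConnectedBelow (suc k) (k , t) (k , j'))
                               (vertical-fresh-unique M w u j' j length-w≡u (maxLetter-bounded w) (x≢0⇒sel j' n') z (sym e)) ε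
    ... | no nz | no nz' with ≢0⇒sel j nz | ≢0⇒sel j' nz'
    ... | i , si , s | i' , si' , s' = down ◅ (connectedBelow-mono (n≤1+n k) C ◅◅ (up ◅ ε))
      where
      same : at w j ≡ at w j'
      same = trans (sym (vertical-old M w u j (x≢0⇒sel j n) nz)) (trans e (vertical-old M w u j' (x≢0⇒sel j' n') nz'))
      s'′ : sel i j' ≡ true
      s'′ = subst (λ t → sel t j' ≡ true) (suc-injective (trans si' (sym si))) s'
      C : ConnectedBelow k (i , j) (i , j')
      C = same-letter⇒connected i j j' si s s'′ same
      i<1+k : i < suc k
      i<1+k = ≤-trans (≤-reflexive si) (n≤1+n k)
      down : StepBelow (suc k) (k , j) (i , j)
      down = stepBelow (x≢0⇒sel j n) s (inj₂ (refl , inj₂ si)) ≤-refl i<1+k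
      up : StepBelow (suc k) (i , j') (k , j')
      up = stepBelow s'′ (x≢0⇒sel j' n') (inj₂ (refl , inj₁ si)) i<1+k ≤-refl

    linked⇒connected : ∀ {j j'} → Linked x j j' → ConnectedBelow (suc k) (k , j) (k , j')
    linked⇒connected ε = ε
    linked⇒connected (s ◅ p) = linkStep⇒connected s ◅◅ linked⇒connected p

    -- Along a path in the first k + 1 rows starting in row k, every cell of row k is linked
    -- to the start in x, and every cell above is connected (below k) to a cell of row k - 1
    -- whose letter is continued at a position linked to the start.
    module Reach (j₀ : ℕ) where
      Reached : Pos → Set
      Reached (i , j) = (i ≡ k × Linked x j₀ j)
        ⊎ (i < k × ∃[ p ] (bitAt u p ≡ true × Linked x j₀ p
                          × ∃[ i' ] (suc i' ≡ k × sel i' p ≡ true × ConnectedBelow k (i , j) (i' , p))))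

      reached-step : ∀ {c d} → Reached c → StepBelow (suc k) c d → Reached d
      reached-step {_ , j₁} {_ , j₂} (inj₁ (refl , L)) (stepBelow s₁ s₂ (inj₁ (refl , h)) _ _) =
        inj₁ (refl , L ◅◅ (linkStep (x≢0 j₁ s₁) (x≢0 j₂ s₂) (inj₂ h) ◅ ε))
      reached-step (inj₁ (refl , L)) (stepBelow s₁ s₂ (inj₂ (refl , inj₁ e)) _ d<) =
        ⊥-elim (1+n≰n (subst (_< _) (sym e) d<))
      reached-step {_ , j₁} {i₂ , _} (inj₁ (refl , L)) (stepBelow s₁ s₂ (inj₂ (refl , inj₂ e)) _ _) =
        inj₂ (≤-reflexive e , j₁ , s₁ , L , i₂ , e , s₂ , ε)
      reached-step {_ , j₁} {i₂ , j₂} (inj₂ (i₁<k , p , sp , L , i' , si' , s' , C)) (stepBelow s₁ s₂ adj _ d<)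
        with i₂ <? k
      ... | yes i₂<k = inj₂ (i₂<k , p , sp , L , i' , si' , s' , stepBelow s₂ s₁ (adj-sym adj) i₂<k i₁<k ◅ C)
      ... | no i₂≮k with ≤∧≮⇒≡ (s≤s⁻¹ d<) i₂≮k | adj
      ... | refl | inj₁ (refl , _) = ⊥-elim (i₂≮k i₁<k)
      ... | refl | inj₂ (refl , inj₂ e) = ⊥-elim (1+n≰n (≤-trans (n≤1+n _) (subst (λ z → suc z ≤ _) (sym e) i₁<k)))
      ... | refl | inj₂ (refl , inj₁ e) with suc-injective (trans si' (sym e))
      ... | refl = inj₁ (refl , L ◅◅ (linkStep (x≢0 p sp) (x≢0 j₁ s₂) (inj₁ x-same) ◅ ε))
        where
        w-same : at w j₁ ≡ at w p
        w-same = connected⇒same-letter i' j₁ p si' C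
        nz₁ : at w j₁ ≢ 0
        nz₁ = sel⇒≢0 i' j₁ si' s₁
        x-same : at x p ≡ at x j₁
        x-same = trans (vertical-old M w u p sp (subst (_≢ 0) w-same nz₁))
                       (trans (sym w-same) (sym (vertical-old M w u j₁ s₂ nz₁)))

      reached-path : ∀ {c d} → Reached c → ConnectedBelow (suc k) c d → Reached d
      reached-path q ε = q
      reached-path q (s ◅ p) = reached-path (reached-step q s) p

    connected⇒linked : ∀ {j j'} → ConnectedBelow (suc k) (k , j) (k , j') → Linked x j j'
    connected⇒linked {j} C with Reach.reached-path j (inj₁ (refl , ε)) C
    ... | inj₁ (_ , L) = L
    ... | inj₂ (k<k , _) = ⊥-elim (1+n≰n k<k)

    reaches-row-k : ∀ i j → i < suc k → sel i j ≡ true → ∃[ j' ] (sel k j' ≡ true × ConnectedBelow (suc k) (i , j) (k , j'))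
    reaches-row-k i j i<1+k s with m≤n⇒m<n∨m≡n (s≤s⁻¹ i<1+k)
    ... | inj₂ refl = j , s , ε
    ... | inj₁ i<k with reaches-last-row i j i<k s
    ... | j' , s' , C with sel⇒≢0 (pred k) j' (<⇒suc-pred≡ i<k) s'
    ... | nz with continues j' nz
    ... | j″ , uj″ , same with ≢0⇒sel j″ (subst (_≢ 0) (sym same) nz)
    ... | i″ , si″ , s″ = j″ , uj″ , connectedBelow-mono (n≤1+n k) (C ◅◅ along) ◅◅ (up ◅ ε)
      where
      s″′ : sel (pred k) j″ ≡ true
      s″′ = subst (λ t → sel t j″ ≡ true) (suc-injective (trans si″ (sym (<⇒suc-pred≡ i<k)))) s″
      along : ConnectedBelow k (pred k , j') (pred k , j″)
      along = same-letter⇒connected (pred k) j' j″ (<⇒suc-pred≡ i<k) s' s″′ (sym same)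
      up : StepBelow (suc k) (pred k , j″) (k , j″)
      up = stepBelow s″′ uj″ (inj₂ (refl , inj₁ (<⇒suc-pred≡ i<k)))
                     (≤-trans (≤-reflexive (<⇒suc-pred≡ i<k)) (n≤1+n k)) ≤-refl

    left⇒l' : ∀ i → i < suc k → sel i 0 ≡ true → l' ≡ true
    left⇒l' i i<1+k s with m≤n⇒m<n∨m≡n (s≤s⁻¹ i<1+k)
    ... | inj₁ i<k rewrite left⇒l i i<k s = refl
    ... | inj₂ refl = ∨≡trueʳ l (trans (headB-bitAt u) s)

    l'⇒left : l' ≡ true → ∃[ i ] (i < suc k × sel i 0 ≡ true)
    l'⇒left e with ∨≡true⁻ l (headB u) e
    ... | inj₁ el = map₂ (map₁ (λ i<k → ≤-trans i<k (n≤1+n k))) (l⇒left el)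
    ... | inj₂ eh = k , ≤-refl , trans (sym (headB-bitAt u)) eh

    lastB-u : lastB u ≡ bitAt u (pred b)
    lastB-u = trans (lastB-bitAt u) (cong (λ z → bitAt u (pred z)) row-length)

    right⇒r' : ∀ i → i < suc k → sel i (pred b) ≡ true → r' ≡ true
    right⇒r' i i<1+k s with m≤n⇒m<n∨m≡n (s≤s⁻¹ i<1+k)
    ... | inj₁ i<k rewrite right⇒r i i<k s = refl
    ... | inj₂ refl = ∨≡trueʳ r (trans lastB-u s)

    r'⇒right : r' ≡ true → ∃[ i ] (i < suc k × sel i (pred b) ≡ true)
    r'⇒right e with ∨≡true⁻ r (lastB u) e
    ... | inj₁ er = map₂ (map₁ (λ i<k → ≤-trans i<k (n≤1+n k))) (r⇒right er)
    ... | inj₂ eh = k , ≤-refl , trans (sym lastB-u) eh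

    step-invariant : RowInvariant (suc k) w' l' r'
    step-invariant = record
      { length-w = trans (canon-length (horizontal x))
                         (trans (length-map _ x) (trans (vertical-length M w u length-w≡u) row-length))
      ; zeros⊎one = canon-zeros⊎one (horizontal x)
      ; sel⇒≢0 = λ { i j refl s → w'≢0 j s }
      ; ≢0⇒sel = λ j ne → k , refl , w'≢0⇒sel j ne
      ; same-letter⇒connected = λ { i j j' refl s s' eq → linked⇒connected
          (horizontal-≡⇒linked j j' (x≢0 j s) (x≢0 j' s') (canon-≡⁻ (horizontal x) j j' (horizontal-≢0 j (x≢0 j s)) eq)) }
      ; connected⇒same-letter = λ { i j j' refl C →
          canon-≡⁺ (horizontal x) j j' (linked⇒horizontal-≡ (connected⇒linked C)) }
      ; reaches-last-row = reaches-row-k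
      ; l⇒left = l'⇒left ; left⇒l = left⇒l' ; r⇒right = r'⇒right ; right⇒r = right⇒r' }

  RowsOfLength : Set
  RowsOfLength = ∀ k → k < length R → length (rowAt R k) ≡ b

  StateInvariant : ℕ → State → Set
  StateInvariant k (w , l , r) = RowInvariant k w l r

  run-invariant : RowsOfLength → ∀ us k w l r {q} → drop k R ≡ us → k ≤ length R → RowInvariant k w l r
                → run (w , l , r) us ≡ just q → StateInvariant (length R) q
  run-invariant rows [] k w l r d k≤ inv refl with drop-[] k R d k≤
  ... | refl = inv
  run-invariant rows (u ∷ us) k w l r d k≤ inv e with drop-∷ {d = []} k R d
  ... | refl , d′ , k< with transitionDefined w (rowAt R k) in defined
  ... | true = run-invariant rows us (suc k) _ _ _ d′ k<
                 (Transition.step-invariant k w l r inv (rows k k<) (transitionDefined⁻ w _ defined)) e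
  ... | false with e
  ... | ()

  run-defined : RowsOfLength → (∀ k w l r → k < length R → RowInvariant k w l r → EveryLetterContinues w (rowAt R k))
              → ∀ us k w l r → drop k R ≡ us → k ≤ length R → RowInvariant k w l r
              → ∃[ q ] (run (w , l , r) us ≡ just q × StateInvariant (length R) q)
  run-defined rows continues [] k w l r d k≤ inv with drop-[] k R d k≤
  ... | refl = (w , l , r) , refl , inv
  run-defined rows continues (u ∷ us) k w l r d k≤ inv with drop-∷ {d = []} k R d
  ... | refl , d′ , k< rewrite δ-defined w l r (rowAt R k) (transitionDefined⁺ w _ (continues k w l r k< inv)) =
        run-defined rows continues us (suc k) _ _ _ d′ k<
          (Transition.step-invariant k w l r inv (rows k k<) (continues k w l r k< inv))

-- Stacks as grids

rowAt-stackRows : ∀ {b h} (s : Stack b h) (i : Fin h) → rowAt (stackRows s) (toℕ i) ≡ V.toList (lookup s i)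
rowAt-stackRows (v V.∷ s) F.zero = refl
rowAt-stackRows (v V.∷ s) (F.suc i) = rowAt-stackRows s i

bitAt-toList : ∀ {n} (v : Vec Bool n) (j : Fin n) → bitAt (V.toList v) (toℕ j) ≡ lookup v j
bitAt-toList (x V.∷ v) F.zero = refl
bitAt-toList (x V.∷ v) (F.suc j) = bitAt-toList v j

length-rowAt-stackRows : ∀ {b h} (s : Stack b h) k → k < h → length (rowAt (stackRows s) k) ≡ b
length-rowAt-stackRows (v V.∷ s) zero _ = length-toList v
length-rowAt-stackRows (v V.∷ s) (suc k) (s≤s k<) = length-rowAt-stackRows s k k<

stackRows-bitAt-true⇒< : ∀ {b h} (s : Stack b h) i j → bitAt (rowAt (stackRows s) i) j ≡ true → i < h × j < b
stackRows-bitAt-true⇒< V.[] i j ()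
stackRows-bitAt-true⇒< (v V.∷ s) zero j e =
  s≤s z≤n , subst (j <_) (length-toList v) (nthOr≢default⇒<length (V.toList v) j λ e' → contradiction (trans (sym e) e') λ ())
stackRows-bitAt-true⇒< (v V.∷ s) (suc i) j e = map₁ s≤s (stackRows-bitAt-true⇒< s i j e)

length-stackRows : ∀ {b h} (s : Stack b h) → length (stackRows s) ≡ h
length-stackRows s = trans (length-map V.toList (V.toList s)) (length-toList s)

≢0∧≤1⇒≡1 : ∀ a → a ≢ 0 → a ≤ 1 → a ≡ 1
≢0∧≤1⇒≡1 zero ne _ = ⊥-elim (ne refl)
≢0∧≤1⇒≡1 (suc zero) _ _ = refl
≢0∧≤1⇒≡1 (suc (suc a)) _ (s≤s ())

module Correspondence (b : ℕ) (1≤b : 1 ≤ b) (h : ℕ) (1≤h : 1 ≤ h) (s : Stack b h) where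
  open Grid b (stackRows s)

  cellsOf-sel : ∀ i j → cellsOf s i j ≡ sel (toℕ i) (toℕ j)
  cellsOf-sel i j = sym (trans (cong (λ row → bitAt row (toℕ j)) (rowAt-stackRows s i)) (bitAt-toList (lookup s i) j))

  toPos : Cell b h → Pos
  toPos (i , j) = toℕ i , toℕ j

  toPos-injective : ∀ c d → toPos c ≡ toPos d → c ≡ d
  toPos-injective (i , j) (i' , j') e = cong₂ _,_ (toℕ-injective (cong proj₁ e)) (toℕ-injective (cong proj₂ e))

  selected⇒Sel : ∀ c → Selected (cellsOf s) c → Sel (toPos c)
  selected⇒Sel (i , j) e = trans (sym (cellsOf-sel i j)) e

  Sel⇒selected : ∀ c {p} → toPos c ≡ p → Sel p → Selected (cellsOf s) c
  Sel⇒selected (i , j) refl e = trans (cellsOf-sel i j) e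

  Sel⇒cell : ∀ p → Sel p → ∃[ c ] (toPos c ≡ p)
  Sel⇒cell (i , j) e with stackRows-bitAt-true⇒< s i j e
  ... | i<h , j<b = (F.fromℕ< i<h , F.fromℕ< j<b) , cong₂ _,_ (toℕ-fromℕ< i<h) (toℕ-fromℕ< j<b)

  Sel⇒selected-fromℕ< : ∀ i j (i<h : i < h) (j<b : j < b) → sel i j ≡ true
                      → cellsOf s (F.fromℕ< i<h) (F.fromℕ< j<b) ≡ true
  Sel⇒selected-fromℕ< i j i<h j<b =
    Sel⇒selected (F.fromℕ< i<h , F.fromℕ< j<b) (cong₂ _,_ (toℕ-fromℕ< i<h) (toℕ-fromℕ< j<b))

  adjacent⇒Adj : ∀ c d → Adjacent c d → Adj (toPos c) (toPos d)
  adjacent⇒Adj (i , j) (i' , j') (inj₁ (e , x)) = inj₁ (cong toℕ e , x)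
  adjacent⇒Adj (i , j) (i' , j') (inj₂ (e , x)) = inj₂ (cong toℕ e , x)

  Adj⇒adjacent : ∀ c d → Adj (toPos c) (toPos d) → Adjacent c d
  Adj⇒adjacent (i , j) (i' , j') (inj₁ (e , x)) = inj₁ (toℕ-injective e , x)
  Adj⇒adjacent (i , j) (i' , j') (inj₂ (e , x)) = inj₂ (toℕ-injective e , x)

  path⇒connectedBelow : ∀ {c d} → Star (Step (cellsOf s)) c d → ConnectedBelow h (toPos c) (toPos d)
  path⇒connectedBelow = gmap toPos λ { {i , j} {i' , j'} (sc , sd , adj) →
    stepBelow (selected⇒Sel _ sc) (selected⇒Sel _ sd) (adjacent⇒Adj _ _ adj) (toℕ<n i) (toℕ<n i') }

  connectedBelow⇒path : ∀ {p q} → ConnectedBelow h p q → ∀ c d → toPos c ≡ p → toPos d ≡ q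
                      → Star (Step (cellsOf s)) c d
  connectedBelow⇒path ε c d refl e = subst (Star (Step (cellsOf s)) c) (toPos-injective c d (sym e)) ε
  connectedBelow⇒path (_◅_ {j = p₁} (stepBelow sp sp₁ adj _ _) rest) c d refl e with Sel⇒cell p₁ sp₁
  ... | c₁ , refl = (Sel⇒selected c refl sp , Sel⇒selected c₁ refl sp₁ , Adj⇒adjacent c c₁ adj)
                    ◅ connectedBelow⇒path rest c₁ d refl e

  rows : RowsOfLength
  rows k k< = length-rowAt-stackRows s k (subst (k <_) (length-stackRows s) k<)

  last<h : pred h < h
  last<h = ≤-reflexive (<⇒suc-pred≡ 1≤h)

  last<b : pred b < b
  last<b = ≤-reflexive (<⇒suc-pred≡ 1≤b)

  in-row : StackOverΣ s → ∀ i (i<h : i < h) → ∃[ i' ] ∃[ j ] (cellsOf s i' j ≡ true × toℕ i' ≡ i)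
  in-row overΣ i i<h with overΣ (F.fromℕ< i<h)
  ... | j , e = F.fromℕ< i<h , j , e , toℕ-fromℕ< i<h

  in-column : ∀ j (j<b : j < b) → ∃[ i ] (i < h × sel i j ≡ true)
            → ∃[ i' ] ∃[ j' ] (cellsOf s i' j' ≡ true × toℕ j' ≡ j)
  in-column j j<b (i , i<h , e) = F.fromℕ< i<h , F.fromℕ< j<b , Sel⇒selected-fromℕ< i j i<h j<b e , toℕ-fromℕ< j<b

  final-invariant : ∀ {q} → run (initialState b) (stackRows s) ≡ just q → StateInvariant h q
  final-invariant {q} e = subst (λ k → StateInvariant k q) (length-stackRows s)
    (run-invariant rows _ 0 (replicate b 0) false false refl z≤n initial-invariant e)

  -- In an accepting state all selected cells of the last row carry the letter 1, and every
  -- cell is connected to the last row.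
  accepting⇒connected : ∀ {w l r} → RowInvariant h w l r → all (λ a → a ≤ᵇ 1) w ≡ true
                      → ∀ p q → Sel p → Sel q → ConnectedBelow h p q
  accepting⇒connected {w} inv letters≤1 (i , j) (i' , j') sp sq
    with reaches-last-row i j (proj₁ (stackRows-bitAt-true⇒< s i j sp)) sp
       | reaches-last-row i' j' (proj₁ (stackRows-bitAt-true⇒< s i' j' sq)) sq
    where open RowInvariant inv
  ... | j₁ , s₁ , C₁ | j₂ , s₂ , C₂ =
    C₁ ◅◅ same-letter⇒connected (pred h) j₁ j₂ (<⇒suc-pred≡ 1≤h) s₁ s₂ (trans (one j₁ s₁) (sym (one j₂ s₂)))
       ◅◅ connectedBelow-sym C₂
    where
    open RowInvariant inv
    one : ∀ j → sel (pred h) j ≡ true → at w j ≡ 1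
    one j s = let nz = sel⇒≢0 (pred h) j (<⇒suc-pred≡ 1≤h) s in
      ≢0∧≤1⇒≡1 (at w j) nz
        (≤ᵇ⇒≤ (at w j) 1 (from T-≡ (all≡true⁻ (λ a → a ≤ᵇ 1) w letters≤1 (at-∈ w j nz))))

  accepted⇒inscribed : StackOverΣ s × AcceptedBy b s → Inscribed (cellsOf s)
  accepted⇒inscribed (overΣ , (w , l , r) , e , accepting) with isAccepting⁻ w accepting
  ... | letters≤1 , l≡true , r≡true =
    (nonempty , connected) , in-row overΣ 0 1≤h , bottom , in-column 0 1≤b (l⇒left l≡true) , right
    where
    inv = final-invariant e
    open RowInvariant inv
    nonempty : ∃[ c ] Selected (cellsOf s) c
    nonempty with in-row overΣ 0 1≤h
    ... | i , j , e , _ = (i , j) , e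
    connected : EdgeConnected (cellsOf s)
    connected c d sc sd = connectedBelow⇒path
      (accepting⇒connected inv letters≤1 (toPos c) (toPos d) (selected⇒Sel c sc) (selected⇒Sel d sd)) c d refl refl
    bottom : ∃[ i ] ∃[ j ] (cellsOf s i j ≡ true × suc (toℕ i) ≡ h)
    bottom with in-row overΣ (pred h) last<h
    ... | i , j , e , i≡ = i , j , e , trans (cong suc i≡) (<⇒suc-pred≡ 1≤h)
    right : ∃[ i ] ∃[ j ] (cellsOf s i j ≡ true × suc (toℕ j) ≡ b)
    right with in-column (pred b) last<b (r⇒right r≡true)
    ... | i , j , e , j≡ = i , j , e , trans (cong suc j≡) (<⇒suc-pred≡ 1≤b)

  module _ (inscribed : Inscribed (cellsOf s)) where
    private
      connected = proj₂ (proj₁ inscribed)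
      top = proj₁ (proj₂ inscribed)
      bottom = proj₁ (proj₂ (proj₂ inscribed))

    connectedBelow : ∀ p q → Sel p → Sel q → ConnectedBelow h p q
    connectedBelow p q sp sq with Sel⇒cell p sp | Sel⇒cell q sq
    ... | c , refl | d , refl =
      path⇒connectedBelow (connected c d (Sel⇒selected c refl sp) (Sel⇒selected d refl sq))

    -- every selected cell is connected to the bottom row, so each path to it that starts
    -- above row k + 1 enters row k + 1 from row k
    crossing-to-bottom : ∀ {k i j} → i < suc k → suc k < h → sel i j ≡ true
                       → ∃[ p ] (sel k p ≡ true × sel (suc k) p ≡ true × ConnectedBelow (suc k) (i , j) (k , p))
    crossing-to-bottom {k} i<1+k 1+k<h sij with bottom
    ... | i₁ , j₁ , e₁ , last = crossing h (suc k) i<1+k (s≤s⁻¹ (subst (suc (suc k) ≤_) (sym last) 1+k<h))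
                                  (connectedBelow _ _ sij (selected⇒Sel (i₁ , j₁) e₁))

    row-selected : ∀ i → i < h → ∃[ j ] sel i j ≡ true
    row-selected zero _ with top
    ... | i , j , e , i≡0 = toℕ j , subst (λ z → sel z (toℕ j) ≡ true) i≡0 (selected⇒Sel (i , j) e)
    row-selected (suc i) i<h with row-selected zero (≤-trans (s≤s z≤n) i<h)
    ... | j , e with crossing-to-bottom (s≤s z≤n) i<h e
    ... | p , _ , e' , _ = p , e'

    overΣ : StackOverΣ s
    overΣ i with row-selected (toℕ i) (toℕ<n i)
    ... | j , e with stackRows-bitAt-true⇒< s (toℕ i) j e
    ... | _ , j<b = F.fromℕ< j<b , Sel⇒selected (i , F.fromℕ< j<b) (cong (toℕ i ,_) (toℕ-fromℕ< j<b)) e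

    letters-continue : ∀ k w l r → k < length (stackRows s) → RowInvariant k w l r → EveryLetterContinues w (rowAt (stackRows s) k)
    letters-continue k w l r k< inv j nz with RowInvariant.≢0⇒sel inv j nz
    ... | i , refl , sij with crossing-to-bottom ≤-refl (subst (_ <_) (length-stackRows s) k<) sij
    ... | p , sip , skp , C = p , skp , sym (RowInvariant.connected⇒same-letter inv i j p refl C)

    left-selected : ∃[ i ] (i < h × sel i 0 ≡ true)
    left-selected with proj₁ (proj₂ (proj₂ (proj₂ inscribed)))
    ... | i , j , e , j≡0 = toℕ i , toℕ<n i , subst (λ z → sel (toℕ i) z ≡ true) j≡0 (selected⇒Sel (i , j) e)

    right-selected : ∃[ i ] (i < h × sel i (pred b) ≡ true)
    right-selected with proj₂ (proj₂ (proj₂ (proj₂ inscribed)))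
    ... | i , j , e , 1+j≡b =
      toℕ i , toℕ<n i , subst (λ z → sel (toℕ i) z ≡ true) (cong pred 1+j≡b) (selected⇒Sel (i , j) e)

    -- a nonzero letter is connected to a cell carrying the letter 1
    final-letters≤1 : ∀ {w l r} → RowInvariant h w l r → all (λ a → a ≤ᵇ 1) w ≡ true
    final-letters≤1 {w} inv = all≡true⁺ _ w one
      where
      open RowInvariant inv
      one : ∀ {a} → a ∈ w → (a ≤ᵇ 1) ≡ true
      one {zero} _ = refl
      one {suc a} a∈w with ∈⇒at a∈w | zeros⊎one
      ... | j , wj , _ | inj₁ zeros = ⊥-elim (0≢1+n (trans (sym (zeros j)) wj))
      ... | j , wj , _ | inj₂ (j₁ , wj₁)
        with ≢0⇒sel j (λ z → 0≢1+n (trans (sym z) wj)) | ≢0⇒sel j₁ (λ z → 0≢1+n (trans (sym z) wj₁))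
      ... | i , refl , sij | _ , refl , sij₁ = subst (λ z → (z ≤ᵇ 1) ≡ true)
        (trans (sym wj₁) (trans (sym (connected⇒same-letter i j j₁ refl (connectedBelow _ _ sij sij₁))) wj)) refl

    final-accepting : ∀ {w l r} → RowInvariant h w l r → IsAccepting (w , l , r)
    final-accepting {w} inv = isAccepting⁺ w (final-letters≤1 inv) l≡true r≡true
      where
      open RowInvariant inv
      l≡true = let i , i<h , e = left-selected in left⇒l i i<h e
      r≡true = let i , i<h , e = right-selected in right⇒r i i<h e

    inscribed⇒accepted : StackOverΣ s × AcceptedBy b s
    inscribed⇒accepted with run-defined rows letters-continue _ 0 (replicate b 0) false false refl z≤n initial-invariant
    ... | q@(w , l , r) , e , inv = overΣ , q , e , final-accepting (subst (λ k → StateInvariant k q) (length-stackRows s) inv)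

mainTheorem1 : (b : ℕ) → 1 ≤ b → (h : ℕ) → 1 ≤ h → (s : Stack b h)
    → (StackOverΣ s × AcceptedBy b s) ⇔ Inscribed (cellsOf s)
mainTheorem1 b 1≤b h 1≤h s = mk⇔ accepted⇒inscribed inscribed⇒accepted
  where open Correspondence b 1≤b h 1≤h s
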